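{- Let $\mathbb{K}$ be a field of characteristic $0$ and $A$ an infinite totally ordered alphabet. Let $\partial:\mathbf{FQSym}\to\mathbf{FQSym}$ be the linear map defined by $\partial \mathbf{G}_\sigma=\mathbf{G}_{\sigma'}$ for $\sigma\in\mathfrak{S}_n$, $n\ge 1$, where $\sigma'\in\mathfrak{S}_{n-1}$ is the permutation whose word is obtained from the word of $\sigma$ by erasing the letter $n$ (and $\partial 1=0$). Then $\partial$ is a derivation of $\mathbf{FQSym}$, i.e. $\partial(FG)=(\partial F)G+F(\partial G)$ for all $F,G\in\mathbf{FQSym}$. Moreover, $\partial$ is the adjoint of the linear map $F\mapsto F\cdot\mathbf{F}_1$ with respect to the scalar product $\langle\cdot,\cdot\rangle$, i.e. $\langle \partial F,H\rangle=\langle F,H\,\mathbf{F}_1\rangle$ for all $F,H\in\mathbf{FQSym}$.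
   Context: The standardization $\mathrm{Std}(w)$ of a word $w$ of length $n$ over $A$ is the permutation of $\mathfrak{S}_n$ obtained by scanning $w$ from left to right and labelling $1,2,\ldots$ the occurrences of its smallest letter, then continuing with the occurrences of the next smallest letter, and so on. For $\sigma\in\mathfrak{S}_n$, $\mathbf{G}_\sigma=\sum_{w\in A^n,\ \mathrm{Std}(w)=\sigma} w\in\mathbb{K}\langle A\rangle$ (with $\mathbf{G}_{\varepsilon}=1$ for the empty permutation). $\mathbf{FQSym}$ is the subalgebra of the free associative algebra $\mathbb{K}\langle A\rangle$ spanned by the $\mathbf{G}_\sigma$; its product is $\mathbf{G}_\alpha\mathbf{G}_\beta=\sum \mathbf{G}_\gamma$, summed over $\gamma\in\mathfrak{S}_{k+l}$ whose word is $u\cdot v$ with $\mathrm{Std}(u)=\alpha\in\mathfrak{S}_k$, $\mathrm{Std}(v)=\beta\in\mathfrak{S}_l$. Set $\mathbf{F}_\sigma=\mathbf{G}_{\sigma^{ -1}}$, and let $\langle\cdot,\cdot\rangle$ be the bilinear form on $\mathbf{FQSym}$ defined by $\langle \mathbf{F}_\sigma,\mathbf{G}_\tau\rangle=\delta_{\sigma,\tau}$. $\mathbf{F}_1=\mathbf{G}_1$ denotes the element indexed by the permutation of $\mathfrak{S}_1$. -}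

module Defs where

open import Level using (_⊔_)
open import Algebra.Bundles using (CommutativeRing)
open import Data.Nat as ℕ using (ℕ; zero; suc; _<?_)
open import Data.List using (List; []; _∷_; [_]; _++_; map; filter; length; take; drop; concatMap; upTo; foldr)
open import Data.List.Properties using (≡-dec)
open import Data.List.Relation.Unary.All using (All)
open import Data.List.Relation.Binary.Permutation.Propositional using (_↭_)
open import Data.Product using (Σ; _×_; _,_; proj₁; ∃)
open import Data.Bool using (Bool; true; false; if_then_else_; _∧_)
open import Relation.Nullary using (¬_; ¬?; _×-dec_)
open import Relation.Nullary.Decidable using (⌊_⌋)
open import Relation.Binary.PropositionalEquality using (_≡_)

range : ℕ → List ℕ
range n = map suc (upTo n)

IsPerm : List ℕ → Set
IsPerm w = w ↭ range (length w)

_≟L_ : (u v : List ℕ) → Bool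
u ≟L v = ⌊ ≡-dec ℕ._≟_ u v ⌋

countLt : ℕ → List ℕ → ℕ
countLt x w = length (filter (_<? x) w)

countEq : ℕ → List ℕ → ℕ
countEq x w = length (filter (ℕ._≟ x) w)

stdAux : List ℕ → List ℕ → List ℕ → List ℕ
stdAux w pre []       = []
stdAux w pre (x ∷ xs) = suc (countLt x w ℕ.+ countEq x pre) ∷ stdAux w (pre ++ [ x ]) xs

Std : List ℕ → List ℕ
Std w = stdAux w [] w

insertAll : ℕ → List ℕ → List (List ℕ)
insertAll x []       = [ x ∷ [] ]
insertAll x (y ∷ ys) = (x ∷ y ∷ ys) ∷ map (y ∷_) (insertAll x ys)

perms : List ℕ → List (List ℕ)
perms []       = [ [] ]
perms (x ∷ xs) = concatMap (insertAll x) (perms xs)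

allPerms : ℕ → List (List ℕ)
allPerms n = perms (range n)

-- position (0-based) of the first occurrence of x in w
indexOf : ℕ → List ℕ → ℕ
indexOf x []       = 0
indexOf x (y ∷ ys) = if ⌊ y ℕ.≟ x ⌋ then 0 else suc (indexOf x ys)

inv : List ℕ → List ℕ
inv w = map (λ i → suc (indexOf i w)) (range (length w))

eraseMax : List ℕ → List ℕ
eraseMax w = filter (λ y → ¬? (y ℕ.≟ length w)) w

shuffleSet : List ℕ → List ℕ → List (List ℕ)
shuffleSet α β =
  filter (λ γ → ≡-dec ℕ._≟_ (Std (take (length α) γ)) α ×-dec ≡-dec ℕ._≟_ (Std (drop (length α) γ)) β)
         (allPerms (length α ℕ.+ length β))

module FieldDefs {c ℓ} (R : CommutativeRing c ℓ) where
  open CommutativeRing R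

  natR : ℕ → Carrier
  natR zero    = 0#
  natR (suc n) = 1# + natR n

  IsFieldChar0 : Set (c ⊔ ℓ)
  IsFieldChar0 =
    (¬ (1# ≈ 0#))
    × (∀ x → ¬ (x ≈ 0#) → Σ Carrier (λ y → x * y ≈ 1#))
    × (∀ n → natR n ≈ 0# → n ≡ 0)

-- FQSym over R, in the basis (G_σ):
-- an element is a finite formal linear combination Σ r · G_σ,
-- represented as a list of pairs (word of σ, r).

module FQSym {c ℓ} (R : CommutativeRing c ℓ) where
  open CommutativeRing R

  FQ : Set c
  FQ = List (List ℕ × Carrier)

  IsFQ : FQ → Set c
  IsFQ F = All (λ t → IsPerm (proj₁ t)) F

  G : List ℕ → FQ
  G σ = [ (σ , 1#) ]

  F : List ℕ → FQ
  F σ = G (inv σ)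

  coeff : FQ → List ℕ → Carrier
  coeff []             σ = 0#
  coeff ((τ , r) ∷ xs) σ = (if τ ≟L σ then r else 0#) + coeff xs σ

  _≈Q_ : FQ → FQ → Set ℓ
  X ≈Q Y = ∀ σ → coeff X σ ≈ coeff Y σ

  _⊕_ : FQ → FQ → FQ
  X ⊕ Y = X ++ Y

  _·_ : FQ → FQ → FQ
  X · Y = concatMap (λ a → concatMap (λ b →
            map (λ γ → (γ , proj₂' a * proj₂' b)) (shuffleSet (proj₁ a) (proj₁ b))) Y) X
    where
    proj₂' : List ℕ × Carrier → Carrier
    proj₂' (_ , r) = r

  ∂ : FQ → FQ
  ∂ []              = []
  ∂ (([] , r) ∷ xs) = ∂ xs
  ∂ ((w@(_ ∷ _) , r) ∷ xs) = (eraseMax w , r) ∷ ∂ xs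

  -- bilinear form with ⟨F_σ, G_τ⟩ = δ_{σ,τ}, i.e. ⟨G_α, G_τ⟩ = δ_{α⁻¹,τ}
  ⟨_,_⟩ : FQ → FQ → Carrier
  ⟨ X , Y ⟩ = foldr _+_ 0# (concatMap (λ a → map (λ b → pair a b) Y) X)
    where
    pair : List ℕ × Carrier → List ℕ × Carrier → Carrier
    pair (α , r) (τ , s) = if inv α ≟L τ then r * s else 0#

-- Both identities are checked coefficientwise, by counting permutations. A permutation γ ∈ 𝔖_{n+1}
-- is determined by γ′ ∈ 𝔖_n and the position of its letter n+1, and standardization commutes with
-- inserting a largest letter. So the γ of G_α G_β with γ′ = σ are the insertions of n+1 into σ either
-- among the first |α| letters, which occur exactly when G_σ occurs in G_{α′} G_β, or among the last
-- |β| letters, which occur exactly when G_σ occurs in G_α G_{β′}: this is the Leibniz rule.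
-- For the adjoint, G_γ occurs in G_τ F_1 = G_τ G_1 iff the first n letters of γ standardize to τ, and
-- for γ = α⁻¹ they standardize to (α′)⁻¹; hence ⟨G_α, G_τ F_1⟩ = ⟨G_{α′}, G_τ⟩ = ⟨∂G_α, G_τ⟩.

module Submission where

open import Defs
open import Algebra.Bundles using (CommutativeRing)
open import Data.Product using (_×_; _,_)
open import Data.List using (List; []; _∷_; [_]; _++_; map; concatMap; foldr)
open import Data.List.Relation.Unary.All using (_∷_)
open import Data.Nat as ℕ using (ℕ)
open import Data.Bool using (true; false; if_then_else_)
import Relation.Binary.PropositionalEquality as ≡

module Counting where

  open import Data.Nat as ℕ using (ℕ; zero; suc; _+_; _*_; _∸_; _≤_; _<_; z≤n; s≤s)
  open import Data.Nat.Properties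
  open import Algebra.Properties.CommutativeSemigroup +-commutativeSemigroup using () renaming (interchange to +-interchange)
  open import Data.Bool using (Bool; true; false; if_then_else_; _∧_)
  open import Data.Empty using (⊥-elim)
  open import Data.Product using (Σ; _×_; _,_; proj₁; proj₂)
  open import Data.Sum using (inj₁; inj₂)
  open import Data.List using (List; []; _∷_; [_]; _++_; map; filter; length; take; drop; concatMap; upTo)
  open import Data.List.Properties
    using (≡-dec; filter-accept; filter-reject; filter-all; filter-++; length-++; length-map; length-take; length-drop;
           map-id-local; map-cong-local; map-∘; map-++; upTo-∷ʳ; length-upTo)
  open import Data.List.Membership.Propositional using (_∈_; _∉_)
  open import Data.List.Membership.DecPropositional ℕ._≟_ using (_∈?_)
  open import Data.List.Relation.Unary.Any using (here; there)
  open import Data.List.Relation.Unary.AllPairs using ([]; _∷_)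
  open import Data.List.Relation.Unary.All as All using (All)
  import Data.List.Relation.Unary.All.Properties as AllP
  open import Data.List.Relation.Unary.Unique.Propositional using (Unique)
  import Data.List.Relation.Unary.Unique.Propositional.Properties as Unique
  open import Data.List.Relation.Unary.Unique.Propositional.Properties using (Unique[x∷xs]⇒x∉xs)
  open import Data.List.Membership.Propositional.Properties using (∈-map⁺; ∈-map⁻; ∈-upTo⁺; ∈-upTo⁻)
  open import Data.List.Relation.Binary.Permutation.Propositional using (_↭_; prep; swap; ↭-refl; ↭-sym; ↭-trans; ↭⇒↭ₛ)
  open import Data.List.Relation.Binary.Permutation.Propositional.Properties using (∈-resp-↭; drop-∷; ↭-empty-inv; ↭-length; ∷↭∷ʳ; filter-↭)
  open import Relation.Nullary using (¬_; ¬?; yes; no; does; _×-dec_)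
  open import Relation.Nullary.Decidable using (⌊_⌋; isYes≗does; dec-true; dec-false)
  open import Relation.Unary using (Decidable)
  open import Function using (_∘_)
  open import Relation.Binary.PropositionalEquality hiding ([_])
  open import Relation.Binary.Definitions using (tri<; tri≈; tri>)
  import Relation.Binary.PropositionalEquality.Properties as PropEq
  import Data.List.Relation.Binary.Permutation.Setoid.Properties (PropEq.setoid ℕ) as ↭ₛ

  -- Finite sums

  𝟙 : Bool → ℕ
  𝟙 true  = 1
  𝟙 false = 0

  𝟙-∧ : ∀ a b → 𝟙 (a ∧ b) ≡ 𝟙 a * 𝟙 b
  𝟙-∧ true  b = sym (+-identityʳ (𝟙 b))
  𝟙-∧ false b = refl

  δ : List ℕ → List ℕ → ℕ
  δ u v = 𝟙 (u ≟L v)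

  δ-refl : ∀ u → δ u u ≡ 1
  δ-refl u with ≡-dec ℕ._≟_ u u
  ... | yes _  = refl
  ... | no u≢u = ⊥-elim (u≢u refl)

  δ-≢ : ∀ {u v} → u ≢ v → δ u v ≡ 0
  δ-≢ {u} {v} u≢v with ≡-dec ℕ._≟_ u v
  ... | yes u≡v = ⊥-elim (u≢v u≡v)
  ... | no _    = refl

  δ-sym : ∀ u v → δ u v ≡ δ v u
  δ-sym u v with ≡-dec ℕ._≟_ u v
  ... | yes refl = sym (δ-refl u)
  ... | no u≢v   = sym (δ-≢ (u≢v ∘ sym))

  ∑ : {A : Set} → List A → (A → ℕ) → ℕ
  ∑ []       f = 0
  ∑ (x ∷ xs) f = f x + ∑ xs f

  infix 5 ∑
  syntax ∑ L (λ x → e) = ∑[ x ∈ L ] e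

  ∑-cong-∈ : {A : Set} (L : List A) {f g : A → ℕ} → (∀ x → x ∈ L → f x ≡ g x) → ∑ L f ≡ ∑ L g
  ∑-cong-∈ []      f≡g = refl
  ∑-cong-∈ (x ∷ L) f≡g = cong₂ _+_ (f≡g x (here refl)) (∑-cong-∈ L (λ y y∈L → f≡g y (there y∈L)))

  ∑-cong : {A : Set} (L : List A) {f g : A → ℕ} → (∀ x → f x ≡ g x) → ∑ L f ≡ ∑ L g
  ∑-cong L f≡g = ∑-cong-∈ L (λ x _ → f≡g x)

  ∑-zero : {A : Set} (L : List A) (f : A → ℕ) → (∀ x → x ∈ L → f x ≡ 0) → ∑ L f ≡ 0
  ∑-zero []      f f≡0 = refl
  ∑-zero (x ∷ L) f f≡0 = cong₂ _+_ (f≡0 x (here refl)) (∑-zero L f (λ y y∈L → f≡0 y (there y∈L)))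

  ∑-++ : {A : Set} (L M : List A) (f : A → ℕ) → ∑ (L ++ M) f ≡ ∑ L f + ∑ M f
  ∑-++ []      M f = refl
  ∑-++ (x ∷ L) M f = trans (cong (f x +_) (∑-++ L M f)) (sym (+-assoc (f x) _ _))

  ∑-map : {A B : Set} (h : A → B) (L : List A) (f : B → ℕ) → ∑ (map h L) f ≡ ∑[ x ∈ L ] f (h x)
  ∑-map h []      f = refl
  ∑-map h (x ∷ L) f = cong (f (h x) +_) (∑-map h L f)

  ∑-concatMap : {A B : Set} (g : A → List B) (L : List A) (f : B → ℕ) →
    ∑ (concatMap g L) f ≡ ∑[ x ∈ L ] ∑ (g x) f
  ∑-concatMap g []      f = refl
  ∑-concatMap g (x ∷ L) f = trans (∑-++ (g x) (concatMap g L) f) (cong (∑ (g x) f +_) (∑-concatMap g L f))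

  ∑-*ˡ : {A : Set} (L : List A) (c : ℕ) (f : A → ℕ) → ∑[ x ∈ L ] c * f x ≡ c * ∑ L f
  ∑-*ˡ []      c f = sym (*-zeroʳ c)
  ∑-*ˡ (x ∷ L) c f = trans (cong (c * f x +_) (∑-*ˡ L c f)) (sym (*-distribˡ-+ c (f x) _))

  ∑-filter : {A : Set} {P : A → Set} (P? : Decidable P) (L : List A) (f : A → ℕ) →
    ∑ (filter P? L) f ≡ ∑[ x ∈ L ] 𝟙 (does (P? x)) * f x
  ∑-filter P? []      f = refl
  ∑-filter P? (x ∷ L) f with P? x
  ... | yes px = cong₂ _+_ (sym (+-identityʳ (f x))) (∑-filter P? L f)
  ... | no ¬px = ∑-filter P? L f

  ∑< : ℕ → (ℕ → ℕ) → ℕ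
  ∑< zero    f = 0
  ∑< (suc n) f = f 0 + ∑< n (λ p → f (suc p))

  infix 5 ∑<
  syntax ∑< n (λ p → e) = ∑[ p < n ] e

  ∑<-cong : ∀ n {f g : ℕ → ℕ} → (∀ p → p < n → f p ≡ g p) → ∑< n f ≡ ∑< n g
  ∑<-cong zero    f≡g = refl
  ∑<-cong (suc n) f≡g = cong₂ _+_ (f≡g 0 (s≤s z≤n)) (∑<-cong n (λ p p<n → f≡g (suc p) (s≤s p<n)))

  ∑<-zero : ∀ n (f : ℕ → ℕ) → (∀ p → p < n → f p ≡ 0) → ∑< n f ≡ 0
  ∑<-zero n f f≡0 = trans (∑<-cong n f≡0) (zeros n)
    where
    zeros : ∀ n → ∑< n (λ _ → 0) ≡ 0
    zeros zero    = refl
    zeros (suc n) = zeros n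

  ∑<-single : ∀ n (f : ℕ → ℕ) i → i < n → (∀ p → p < n → p ≢ i → f p ≡ 0) → ∑< n f ≡ f i
  ∑<-single (suc n) f zero    _ f≡0 =
    trans (cong (f 0 +_) (∑<-zero n _ (λ p p<n → f≡0 (suc p) (s≤s p<n) (λ ())))) (+-identityʳ _)
  ∑<-single (suc n) f (suc i) (s≤s i<n) f≡0 =
    trans (cong (_+ ∑< n (λ p → f (suc p))) (f≡0 0 (s≤s z≤n) (λ ())))
          (∑<-single n _ i i<n (λ p p<n p≢i → f≡0 (suc p) (s≤s p<n) (p≢i ∘ suc-injective)))

  ∑<-+ : ∀ k l f → ∑< (k + l) f ≡ ∑< k f + (∑[ q < l ] f (k + q))
  ∑<-+ zero    l f = refl
  ∑<-+ (suc k) l f = trans (cong (f 0 +_) (∑<-+ k l (λ p → f (suc p)))) (sym (+-assoc (f 0) _ _))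

  ∑<-*ʳ : ∀ n f c → ∑[ p < n ] f p * c ≡ ∑< n f * c
  ∑<-*ʳ zero    f c = refl
  ∑<-*ʳ (suc n) f c = trans (cong (f 0 * c +_) (∑<-*ʳ n (λ p → f (suc p)) c)) (sym (*-distribʳ-+ c (f 0) _))

  ∑<-*ˡ : ∀ n f c → ∑[ p < n ] c * f p ≡ c * ∑< n f
  ∑<-*ˡ n f c = trans (∑<-cong n (λ p _ → *-comm c (f p))) (trans (∑<-*ʳ n f c) (*-comm _ c))

  ∑<-distrib-+ : ∀ n (f g : ℕ → ℕ) → ∑[ p < n ] (f p + g p) ≡ ∑< n f + ∑< n g
  ∑<-distrib-+ zero    f g = refl
  ∑<-distrib-+ (suc n) f g = trans (cong (f 0 + g 0 +_) (∑<-distrib-+ n _ _)) (+-interchange (f 0) (g 0) _ _)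

  ∑-∑<-comm : {A : Set} (L : List A) (n : ℕ) (f : A → ℕ → ℕ) → ∑[ x ∈ L ] ∑< n (f x) ≡ ∑[ p < n ] ∑[ x ∈ L ] f x p
  ∑-∑<-comm []      n f = sym (∑<-zero n _ (λ _ _ → refl))
  ∑-∑<-comm (x ∷ L) n f = trans (cong (∑< n (f x) +_) (∑-∑<-comm L n f)) (sym (∑<-distrib-+ n (f x) _))

  -- Inserting a letter, and enumerating permutations

  ⌊≟⌋-refl : ∀ m → ⌊ m ℕ.≟ m ⌋ ≡ true
  ⌊≟⌋-refl m = trans (isYes≗does (m ℕ.≟ m)) (dec-true (m ℕ.≟ m) refl)

  ⌊≟⌋-≢ : ∀ {x y} → x ≢ y → ⌊ x ℕ.≟ y ⌋ ≡ false
  ⌊≟⌋-≢ {x} {y} x≢y = trans (isYes≗does (x ℕ.≟ y)) (dec-false (x ℕ.≟ y) x≢y)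

  insertAt : ℕ → ℕ → List ℕ → List ℕ
  insertAt zero    m xs       = m ∷ xs
  insertAt (suc p) m []       = m ∷ []
  insertAt (suc p) m (x ∷ xs) = x ∷ insertAt p m xs

  removeFirst : ℕ → List ℕ → List ℕ
  removeFirst x []       = []
  removeFirst x (y ∷ ys) = if ⌊ y ℕ.≟ x ⌋ then ys else y ∷ removeFirst x ys

  insertAt-↭ : ∀ p m xs → insertAt p m xs ↭ m ∷ xs
  insertAt-↭ zero    m xs       = ↭-refl
  insertAt-↭ (suc p) m []       = ↭-refl
  insertAt-↭ (suc p) m (x ∷ xs) = ↭-trans (prep x (insertAt-↭ p m xs)) (swap x m ↭-refl)

  length-insertAt : ∀ p m xs → length (insertAt p m xs) ≡ suc (length xs)
  length-insertAt p m xs = ↭-length (insertAt-↭ p m xs)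

  ∈-insertAt : ∀ p m xs → m ∈ insertAt p m xs
  ∈-insertAt p m xs = ∈-resp-↭ (↭-sym (insertAt-↭ p m xs)) (here refl)

  indexOf-insertAt : ∀ p m xs → m ∉ xs → p ≤ length xs → indexOf m (insertAt p m xs) ≡ p
  indexOf-insertAt zero    m xs       _   _ rewrite ⌊≟⌋-refl m = refl
  indexOf-insertAt (suc p) m (x ∷ xs) m∉ (s≤s p≤) rewrite ⌊≟⌋-≢ {x} {m} (λ x≡m → m∉ (here (sym x≡m))) =
    cong suc (indexOf-insertAt p m xs (m∉ ∘ there) p≤)

  removeFirst-insertAt : ∀ p m xs → m ∉ xs → removeFirst m (insertAt p m xs) ≡ xs
  removeFirst-insertAt zero    m xs       _ rewrite ⌊≟⌋-refl m = refl
  removeFirst-insertAt (suc p) m []       _ rewrite ⌊≟⌋-refl m = refl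
  removeFirst-insertAt (suc p) m (x ∷ xs) m∉ rewrite ⌊≟⌋-≢ {x} {m} (λ x≡m → m∉ (here (sym x≡m))) =
    cong (x ∷_) (removeFirst-insertAt p m xs (m∉ ∘ there))

  insertAt-removeFirst : ∀ x w → x ∈ w → insertAt (indexOf x w) x (removeFirst x w) ≡ w
  insertAt-removeFirst x (y ∷ ys) x∈ with y ℕ.≟ x
  insertAt-removeFirst x (y ∷ ys) x∈          | yes refl = refl
  insertAt-removeFirst x (y ∷ ys) (here refl) | no y≢x   = ⊥-elim (y≢x refl)
  insertAt-removeFirst x (y ∷ ys) (there x∈)  | no _     = cong (y ∷_) (insertAt-removeFirst x ys x∈)

  indexOf< : ∀ x w → x ∈ w → indexOf x w < length w
  indexOf< x (y ∷ ys) x∈ with y ℕ.≟ x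
  indexOf< x (y ∷ ys) x∈          | yes _  = s≤s z≤n
  indexOf< x (y ∷ ys) (here refl) | no y≢x = ⊥-elim (y≢x refl)
  indexOf< x (y ∷ ys) (there x∈)  | no _   = s≤s (indexOf< x ys x∈)

  removeFirst-↭ : ∀ x w → x ∈ w → w ↭ x ∷ removeFirst x w
  removeFirst-↭ x w x∈ =
    subst (_↭ x ∷ removeFirst x w) (insertAt-removeFirst x w x∈) (insertAt-↭ (indexOf x w) x (removeFirst x w))

  -- Only the position of m in w can give w, and it does iff removing m from w gives u.
  ∑<-δ-insertAt : ∀ m u w → m ∉ u →
    ∑[ p < suc (length u) ] δ (insertAt p m u) w ≡ 𝟙 (⌊ m ∈? w ⌋ ∧ (removeFirst m w ≟L u))
  ∑<-δ-insertAt m u w m∉u with m ∈? w | ≡-dec ℕ._≟_ (removeFirst m w) u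
  ... | no m∉w | _ = ∑<-zero (suc (length u)) (λ p → δ (insertAt p m u) w) (λ p _ → δ-≢ (λ ins≡w →
          m∉w (subst (m ∈_) ins≡w (∈-insertAt p m u))))
  ... | yes _ | no rm≢u = ∑<-zero (suc (length u)) (λ p → δ (insertAt p m u) w) (λ p _ → δ-≢ (λ ins≡w →
          rm≢u (trans (cong (removeFirst m) (sym ins≡w)) (removeFirst-insertAt p m u m∉u))))
  ... | yes m∈w | yes refl =
    trans (∑<-single _ _ (indexOf m w) i< elsewhere) (trans (cong (λ v → δ v w) (insertAt-removeFirst m w m∈w)) (δ-refl w))
    where
    i< : indexOf m w < suc (length (removeFirst m w))
    i< = subst (indexOf m w <_) (↭-length (removeFirst-↭ m w m∈w)) (indexOf< m w m∈w)
    elsewhere : ∀ p → p < suc (length (removeFirst m w)) → p ≢ indexOf m w → δ (insertAt p m (removeFirst m w)) w ≡ 0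
    elsewhere p (s≤s p≤) p≢i = δ-≢ (λ ins≡w → p≢i (trans (sym (indexOf-insertAt p m _ m∉u p≤)) (cong (indexOf m) ins≡w)))

  isPermOf : List ℕ → List ℕ → Bool
  isPermOf []       []      = true
  isPermOf []       (_ ∷ _) = false
  isPermOf (x ∷ xs) w       = ⌊ x ∈? w ⌋ ∧ isPermOf xs (removeFirst x w)

  isPermOf-sound : ∀ l w → isPermOf l w ≡ true → w ↭ l
  isPermOf-sound []       []       _ = ↭-refl
  isPermOf-sound (x ∷ xs) w isPerm with x ∈? w
  ... | yes x∈w = ↭-trans (removeFirst-↭ x w x∈w) (prep x (isPermOf-sound xs (removeFirst x w) isPerm))

  isPermOf-complete : ∀ l w → w ↭ l → isPermOf l w ≡ true
  isPermOf-complete []       w w↭[] rewrite ↭-empty-inv w↭[] = refl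
  isPermOf-complete (x ∷ xs) w w↭l with x ∈? w
  ... | no x∉w  = ⊥-elim (x∉w (∈-resp-↭ (↭-sym w↭l) (here refl)))
  ... | yes x∈w = isPermOf-complete xs (removeFirst x w) (drop-∷ (↭-trans (↭-sym (removeFirst-↭ x w x∈w)) w↭l))

  𝟙-pos : ∀ {b} → 1 ≤ 𝟙 b → b ≡ true
  𝟙-pos {true} _ = refl

  mult : List (List ℕ) → List ℕ → ℕ
  mult L v = ∑[ γ ∈ L ] δ γ v

  ∈⇒1≤mult : ∀ {L v} → v ∈ L → 1 ≤ mult L v
  ∈⇒1≤mult {γ ∷ L} (here refl) rewrite δ-refl γ = s≤s z≤n
  ∈⇒1≤mult {γ ∷ L} (there v∈L) = ≤-trans (∈⇒1≤mult v∈L) (m≤n+m _ _)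

  ∑-insertAll : ∀ x u (f : List ℕ → ℕ) → ∑ (insertAll x u) f ≡ ∑[ p < suc (length u) ] f (insertAt p x u)
  ∑-insertAll x []       f = refl
  ∑-insertAll x (y ∷ ys) f =
    cong (f (x ∷ y ∷ ys) +_) (trans (∑-map (y ∷_) (insertAll x ys) f) (∑-insertAll x ys (f ∘ (y ∷_))))

  mult-perms : ∀ l → Unique l → ∀ w → mult (perms l) w ≡ 𝟙 (isPermOf l w)
  mult-perms []       _ []      = refl
  mult-perms []       _ (_ ∷ _) = refl
  mult-perms (x ∷ xs) (x∉xs ∷ xs-unique) w = begin
      ∑[ γ ∈ concatMap (insertAll x) (perms xs) ] δ γ w
    ≡⟨ ∑-concatMap (insertAll x) (perms xs) _ ⟩
      ∑[ u ∈ perms xs ] ∑[ γ ∈ insertAll x u ] δ γ w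
    ≡⟨ ∑-cong-∈ (perms xs) insertions ⟩
      ∑[ u ∈ perms xs ] 𝟙 ⌊ x ∈? w ⌋ * δ u (removeFirst x w)
    ≡⟨ ∑-*ˡ (perms xs) (𝟙 ⌊ x ∈? w ⌋) _ ⟩
      𝟙 ⌊ x ∈? w ⌋ * mult (perms xs) (removeFirst x w)
    ≡⟨ cong (𝟙 ⌊ x ∈? w ⌋ *_) (mult-perms xs xs-unique (removeFirst x w)) ⟩
      𝟙 ⌊ x ∈? w ⌋ * 𝟙 (isPermOf xs (removeFirst x w))
    ≡⟨ 𝟙-∧ ⌊ x ∈? w ⌋ _ ⟨
      𝟙 (isPermOf (x ∷ xs) w)
    ∎
    where
    open ≡-Reasoning
    ∈-perms⇒↭ : ∀ {u} → u ∈ perms xs → u ↭ xs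
    ∈-perms⇒↭ {u} u∈ = isPermOf-sound xs u (𝟙-pos (subst (1 ≤_) (mult-perms xs xs-unique u) (∈⇒1≤mult u∈)))
    insertions : ∀ u → u ∈ perms xs → ∑[ γ ∈ insertAll x u ] δ γ w ≡ 𝟙 ⌊ x ∈? w ⌋ * δ u (removeFirst x w)
    insertions u u∈ = begin
        ∑[ γ ∈ insertAll x u ] δ γ w
      ≡⟨ ∑-insertAll x u _ ⟩
        ∑[ p < suc (length u) ] δ (insertAt p x u) w
      ≡⟨ ∑<-δ-insertAt x u w (λ x∈u → All.lookup x∉xs (∈-resp-↭ (∈-perms⇒↭ u∈) x∈u) refl) ⟩
        𝟙 (⌊ x ∈? w ⌋ ∧ (removeFirst x w ≟L u))
      ≡⟨ 𝟙-∧ ⌊ x ∈? w ⌋ _ ⟩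
        𝟙 ⌊ x ∈? w ⌋ * δ (removeFirst x w) u
      ≡⟨ cong (𝟙 ⌊ x ∈? w ⌋ *_) (δ-sym (removeFirst x w) u) ⟩
        𝟙 ⌊ x ∈? w ⌋ * δ u (removeFirst x w)
      ∎

  Unique-resp-↭ : ∀ {xs ys : List ℕ} → xs ↭ ys → Unique xs → Unique ys
  Unique-resp-↭ xs↭ys = ↭ₛ.Unique-resp-↭ (↭⇒↭ₛ xs↭ys)

  Unique-tail : ∀ {x} {xs : List ℕ} → Unique (x ∷ xs) → Unique xs
  Unique-tail (_ ∷ xs-unique) = xs-unique

  range-suc : ∀ n → range (suc n) ≡ range n ++ [ suc n ]
  range-suc n = trans (cong (map suc) (sym (upTo-∷ʳ n))) (map-++ suc (upTo n) [ n ])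

  range-suc-↭ : ∀ n → suc n ∷ range n ↭ range (suc n)
  range-suc-↭ n = subst (suc n ∷ range n ↭_) (sym (range-suc n)) (∷↭∷ʳ (suc n) (range n))

  length-range : ∀ n → length (range n) ≡ n
  length-range n = trans (length-map suc (upTo n)) (length-upTo n)

  range-unique : ∀ n → Unique (range n)
  range-unique n = Unique.map⁺ suc-injective (Unique.upTo⁺ n)

  ∈-range⁻ : ∀ {x n} → x ∈ range n → 1 ≤ x × x ≤ n
  ∈-range⁻ x∈ with ∈-map⁻ suc x∈
  ... | i , i∈ , refl = s≤s z≤n , ∈-upTo⁻ i∈

  ∈-range⁺ : ∀ {x n} → 1 ≤ x → x ≤ n → x ∈ range n
  ∈-range⁺ {suc i} _ x≤n = ∈-map⁺ suc (∈-upTo⁺ x≤n)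

  Perm : ℕ → List ℕ → Set
  Perm n w = w ↭ range n

  Perm-length : ∀ {n w} → Perm n w → length w ≡ n
  Perm-length {n} w↭ = trans (↭-length w↭) (length-range n)

  Perm-unique : ∀ {n w} → Perm n w → Unique w
  Perm-unique {n} w↭ = Unique-resp-↭ (↭-sym w↭) (range-unique n)

  Perm-∈ : ∀ {n w x} → Perm n w → x ∈ w → 1 ≤ x × x ≤ n
  Perm-∈ w↭ x∈ = ∈-range⁻ (∈-resp-↭ w↭ x∈)

  Perm-∋ : ∀ {n w x} → Perm n w → 1 ≤ x → x ≤ n → x ∈ w
  Perm-∋ w↭ 1≤x x≤n = ∈-resp-↭ (↭-sym w↭) (∈-range⁺ 1≤x x≤n)

  Perm-< : ∀ {n w} → Perm n w → All (_< suc n) w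
  Perm-< w↭ = All.tabulate (λ x∈ → s≤s (proj₂ (Perm-∈ w↭ x∈)))

  Perm-max∈ : ∀ {n w} → Perm (suc n) w → suc n ∈ w
  Perm-max∈ w↭ = Perm-∋ w↭ (s≤s z≤n) ≤-refl

  Perm-insertAt : ∀ {n σ} p → Perm n σ → Perm (suc n) (insertAt p (suc n) σ)
  Perm-insertAt {n} {σ} p σ↭ = ↭-trans (insertAt-↭ p (suc n) σ) (↭-trans (prep (suc n) σ↭) (range-suc-↭ n))

  Perm-removeFirst : ∀ {n w} → Perm (suc n) w → Perm n (removeFirst (suc n) w)
  Perm-removeFirst {n} {w} w↭ =
    drop-∷ (↭-trans (↭-sym (removeFirst-↭ (suc n) w (Perm-max∈ w↭))) (↭-trans w↭ (↭-sym (range-suc-↭ n))))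

  mult-allPerms : ∀ n w → mult (allPerms n) w ≡ 𝟙 (isPermOf (range n) w)
  mult-allPerms n = mult-perms (range n) (range-unique n)

  mult-allPerms-Perm : ∀ {n w} → Perm n w → mult (allPerms n) w ≡ 1
  mult-allPerms-Perm {n} {w} w↭ = trans (mult-allPerms n w) (cong 𝟙 (isPermOf-complete (range n) w w↭))

  ∈-allPerms⇒Perm : ∀ {n γ} → γ ∈ allPerms n → Perm n γ
  ∈-allPerms⇒Perm {n} {γ} γ∈ = isPermOf-sound (range n) γ (𝟙-pos (subst (1 ≤_) (mult-allPerms n γ) (∈⇒1≤mult γ∈)))

  Bounded : ℕ → List ℕ → Set
  Bounded n w = ∀ {x} → x ∈ w → 1 ≤ x × x ≤ n

  Bounded-weaken : ∀ {n w} → suc n ∉ w → Bounded (suc n) w → Bounded n w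
  Bounded-weaken {n} m∉w bounded x∈ with bounded x∈
  ... | 1≤x , x≤1+n with m≤n⇒m<n∨m≡n x≤1+n
  ...   | inj₁ x<1+n = 1≤x , ≤-pred x<1+n
  ...   | inj₂ refl  = ⊥-elim (m∉w x∈)

  Bounded-removeFirst : ∀ {n w} → Unique w → suc n ∈ w → Bounded (suc n) w →
    Unique (removeFirst (suc n) w) × Bounded n (removeFirst (suc n) w)
  Bounded-removeFirst {n} {w} w-unique m∈w bounded =
    Unique-tail unique′ , Bounded-weaken (Unique[x∷xs]⇒x∉xs unique′) (λ x∈ → bounded (∈-resp-↭ (↭-sym w↭) (there x∈)))
    where
    w↭ = removeFirst-↭ (suc n) w m∈w
    unique′ = Unique-resp-↭ w↭ w-unique

  unique-bounded⇒length≤ : ∀ n w → Unique w → Bounded n w → length w ≤ n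
  unique-bounded⇒length≤ zero    []      _ _ = z≤n
  unique-bounded⇒length≤ zero    (x ∷ w) _ bounded with bounded (here refl)
  ... | s≤s z≤n , ()
  unique-bounded⇒length≤ (suc n) w w-unique bounded with suc n ∈? w
  ... | yes m∈w = let unique′ , bounded′ = Bounded-removeFirst w-unique m∈w bounded in
    subst (_≤ suc n) (sym (↭-length (removeFirst-↭ (suc n) w m∈w))) (s≤s (unique-bounded⇒length≤ n _ unique′ bounded′))
  ... | no m∉w  = m≤n⇒m≤1+n (unique-bounded⇒length≤ n w w-unique (Bounded-weaken m∉w bounded))

  unique-bounded⇒Perm : ∀ n w → Unique w → Bounded n w → length w ≡ n → Perm n w
  unique-bounded⇒Perm zero    []  _ _ _ = ↭-refl
  unique-bounded⇒Perm (suc n) w w-unique bounded |w|≡1+n with suc n ∈? w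
  ... | yes m∈w = let unique′ , bounded′ = Bounded-removeFirst w-unique m∈w bounded
                      w↭ = removeFirst-↭ (suc n) w m∈w
                      |w′|≡n = suc-injective (trans (sym (↭-length w↭)) |w|≡1+n)
                  in ↭-trans w↭ (↭-trans (prep (suc n) (unique-bounded⇒Perm n _ unique′ bounded′ |w′|≡n)) (range-suc-↭ n))
  ... | no m∉w  = ⊥-elim (<-irrefl refl (subst (_≤ n) |w|≡1+n
                    (unique-bounded⇒length≤ n w w-unique (Bounded-weaken m∉w bounded))))

  filter-≢-removeFirst : ∀ m w → Unique w → filter (λ y → ¬? (y ℕ.≟ m)) w ≡ removeFirst m w
  filter-≢-removeFirst m []       _ = refl
  filter-≢-removeFirst m (y ∷ ys) (y∉ys ∷ ys-unique) with y ℕ.≟ m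
  ... | yes refl = trans (filter-reject (λ y → ¬? (y ℕ.≟ m)) (λ y≢y → y≢y refl))
                         (filter-all (λ y → ¬? (y ℕ.≟ m)) (All.map (λ y≢z z≡y → y≢z (sym z≡y)) y∉ys))
  ... | no y≢m   = trans (filter-accept (λ y → ¬? (y ℕ.≟ m)) y≢m) (cong (y ∷_) (filter-≢-removeFirst m ys ys-unique))

  eraseMax≡removeFirst : ∀ {n w} → Perm (suc n) w → eraseMax w ≡ removeFirst (suc n) w
  eraseMax≡removeFirst {n} {w} w↭ =
    trans (cong (λ k → filter (λ y → ¬? (y ℕ.≟ k)) w) (Perm-length w↭)) (filter-≢-removeFirst (suc n) w (Perm-unique w↭))

  eraseMax-Perm : ∀ {n w} → Perm (suc n) w → Perm n (eraseMax w)
  eraseMax-Perm {n} w↭ = subst (Perm n) (sym (eraseMax≡removeFirst w↭)) (Perm-removeFirst w↭)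

  insertAt-eraseMax : ∀ {n w} → Perm (suc n) w → insertAt (indexOf (suc n) w) (suc n) (eraseMax w) ≡ w
  insertAt-eraseMax {n} {w} w↭ =
    trans (cong (insertAt (indexOf (suc n) w) (suc n)) (eraseMax≡removeFirst w↭)) (insertAt-removeFirst (suc n) w (Perm-max∈ w↭))

  indexOf-max≤ : ∀ {n w} → Perm (suc n) w → indexOf (suc n) w ≤ n
  indexOf-max≤ {n} {w} w↭ = ≤-pred (subst (indexOf (suc n) w <_) (Perm-length w↭) (indexOf< (suc n) w (Perm-max∈ w↭)))

  max∉eraseMax : ∀ {n w} → Perm (suc n) w → suc n ∉ eraseMax w
  max∉eraseMax w↭ m∈ = <-irrefl refl (proj₂ (Perm-∈ (eraseMax-Perm w↭) m∈))

  -- Standardization and inverses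

  countLt-++ : ∀ x u v → countLt x (u ++ v) ≡ countLt x u + countLt x v
  countLt-++ x u v = trans (cong length (filter-++ (ℕ._<? x) u v)) (length-++ (filter (ℕ._<? x) u))

  countEq-++ : ∀ x u v → countEq x (u ++ v) ≡ countEq x u + countEq x v
  countEq-++ x u v = trans (cong length (filter-++ (ℕ._≟ x) u v)) (length-++ (filter (ℕ._≟ x) u))

  countEq-≢ : ∀ {x y} → y ≢ x → countEq x [ y ] ≡ 0
  countEq-≢ {x} y≢x = cong length (filter-reject (ℕ._≟ x) {xs = []} y≢x)

  countEq-snoc-≢ : ∀ {x y} pre → y ≢ x → countEq x (pre ++ [ y ]) ≡ countEq x pre
  countEq-snoc-≢ {x} pre y≢x = trans (countEq-++ x pre _) (trans (cong (countEq x pre +_) (countEq-≢ y≢x)) (+-identityʳ _))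

  countLt-≮ : ∀ {x y} → ¬ y < x → countLt x [ y ] ≡ 0
  countLt-≮ {x} y≮x = cong length (filter-reject (ℕ._<? x) {xs = []} y≮x)

  countLt-↭ : ∀ x {u v} → u ↭ v → countLt x u ≡ countLt x v
  countLt-↭ x u↭v = ↭-length (filter-↭ (ℕ._<? x) u↭v)

  countLt-insertAt : ∀ x p m u → ¬ m < x → countLt x (insertAt p m u) ≡ countLt x u
  countLt-insertAt x p m u m≮x = trans (countLt-↭ x (insertAt-↭ p m u)) (cong length (filter-reject (ℕ._<? x) m≮x))

  countLt-all : ∀ m u → All (_< m) u → countLt m u ≡ length u
  countLt-all m u all< = cong length (filter-all (ℕ._<? m) all<)

  stdAux-cong : ∀ m {w w′ pre pre′} xs →
    (∀ x → x < m → countLt x w ≡ countLt x w′) → (∀ x → x < m → countEq x pre ≡ countEq x pre′) →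
    All (_< m) xs → stdAux w pre xs ≡ stdAux w′ pre′ xs
  stdAux-cong m []       _     _     _               = refl
  stdAux-cong m {pre = pre} {pre′} (x ∷ xs) lt≡ eq≡ (x<m All.∷ xs<m) =
    cong₂ _∷_ (cong suc (cong₂ _+_ (lt≡ x x<m) (eq≡ x x<m))) (stdAux-cong m xs lt≡ eq≡′ xs<m)
    where
    eq≡′ : ∀ y → y < m → countEq y (pre ++ [ x ]) ≡ countEq y (pre′ ++ [ x ])
    eq≡′ y y<m = trans (countEq-++ y pre _) (trans (cong (_+ countEq y [ x ]) (eq≡ y y<m)) (sym (countEq-++ y pre′ _)))

  -- As m exceeds every letter of xs, inserting it leaves the other labels unchanged and m gets the top label.
  stdAux-insertAt : ∀ p m {w′ w pre′ pre} xs →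
    (∀ x → x < m → countLt x w′ ≡ countLt x w) → countLt m w′ ≡ length w →
    (∀ x → x < m → countEq x pre′ ≡ countEq x pre) → countEq m pre′ ≡ 0 →
    All (_< m) xs → stdAux w′ pre′ (insertAt p m xs) ≡ insertAt p (suc (length w)) (stdAux w pre xs)
  stdAux-insertAt zero m {pre′ = pre′} xs lt≡ top eq≡ m∉pre′ xs<m =
    cong₂ _∷_ (cong suc (trans (cong₂ _+_ top m∉pre′) (+-identityʳ _)))
      (stdAux-cong m xs lt≡ (λ y y<m → trans (countEq-snoc-≢ pre′ (λ m≡y → <-irrefl (sym m≡y) y<m)) (eq≡ y y<m)) xs<m)
  stdAux-insertAt (suc p) m [] lt≡ top eq≡ m∉pre′ xs<m =
    cong [_] (cong suc (trans (cong₂ _+_ top m∉pre′) (+-identityʳ _)))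
  stdAux-insertAt (suc p) m {pre′ = pre′} {pre} (x ∷ xs) lt≡ top eq≡ m∉pre′ (x<m All.∷ xs<m) =
    cong₂ _∷_ (cong suc (cong₂ _+_ (lt≡ x x<m) (eq≡ x x<m)))
      (stdAux-insertAt p m xs lt≡ top eq≡′ (trans (countEq-snoc-≢ pre′ (λ x≡m → <-irrefl x≡m x<m)) m∉pre′) xs<m)
    where
    eq≡′ : ∀ y → y < m → countEq y (pre′ ++ [ x ]) ≡ countEq y (pre ++ [ x ])
    eq≡′ y y<m = trans (countEq-++ y pre′ _) (trans (cong (_+ countEq y [ x ]) (eq≡ y y<m)) (sym (countEq-++ y pre _)))

  Std-insertAt : ∀ p m u → All (_< m) u → Std (insertAt p m u) ≡ insertAt p (suc (length u)) (Std u)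
  Std-insertAt p m u u<m = stdAux-insertAt p m u
    (λ x x<m → countLt-insertAt x p m u (<-asym x<m))
    (trans (countLt-insertAt m p m u (<-irrefl refl)) (countLt-all m u u<m))
    (λ _ _ → refl) refl u<m

  stdAux-unique : ∀ w pre xs → Unique xs → (∀ y → y ∈ xs → countEq y pre ≡ 0) →
    stdAux w pre xs ≡ map (λ x → suc (countLt x w)) xs
  stdAux-unique w pre []       _ _ = refl
  stdAux-unique w pre (x ∷ xs) (x∉xs ∷ xs-unique) fresh =
    cong₂ _∷_ (cong suc (trans (cong (countLt x w +_) (fresh x (here refl))) (+-identityʳ _)))
      (stdAux-unique w (pre ++ [ x ]) xs xs-unique
        (λ y y∈xs → trans (countEq-snoc-≢ pre (λ x≡y → All.lookup x∉xs y∈xs x≡y)) (fresh y (there y∈xs))))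

  countLt-range : ∀ n x → 1 ≤ x → x ≤ n → countLt x (range n) ≡ ℕ.pred x
  countLt-range zero    x (s≤s z≤n) ()
  countLt-range (suc n) x 1≤x x≤1+n with m≤n⇒m<n∨m≡n x≤1+n
  ... | inj₁ (s≤s x≤n) = begin
      countLt x (range (suc n))                         ≡⟨ cong (countLt x) (range-suc n) ⟩
      countLt x (range n ++ [ suc n ])                  ≡⟨ countLt-++ x (range n) _ ⟩
      countLt x (range n) + countLt x [ suc n ]         ≡⟨ cong₂ _+_ (countLt-range n x 1≤x x≤n) (countLt-≮ (<⇒≱ (s≤s x≤n) ∘ <⇒≤)) ⟩
      ℕ.pred x + 0                                      ≡⟨ +-identityʳ _ ⟩
      ℕ.pred x                                          ∎
    where open ≡-Reasoning
  ... | inj₂ refl = begin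
      countLt (suc n) (range (suc n))                   ≡⟨ cong (countLt (suc n)) (range-suc n) ⟩
      countLt (suc n) (range n ++ [ suc n ])            ≡⟨ countLt-++ (suc n) (range n) _ ⟩
      countLt (suc n) (range n) + countLt (suc n) [ suc n ] ≡⟨ cong₂ _+_ (countLt-all (suc n) (range n) (Perm-< ↭-refl)) (countLt-≮ {suc n} (<-irrefl refl)) ⟩
      length (range n) + 0                              ≡⟨ trans (+-identityʳ _) (length-range n) ⟩
      n                                                 ∎
    where open ≡-Reasoning

  Std-Perm : ∀ {n σ} → Perm n σ → Std σ ≡ σ
  Std-Perm {n} {σ} σ↭ = trans (stdAux-unique σ [] σ (Perm-unique σ↭) (λ _ _ → refl)) (map-id-local (All.tabulate label≡))
    where
    label≡ : ∀ {x} → x ∈ σ → suc (countLt x σ) ≡ x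
    label≡ {x} x∈σ with Perm-∈ σ↭ x∈σ
    ... | 1≤x@(s≤s _) , x≤n = cong suc (trans (countLt-↭ x σ↭) (countLt-range n x 1≤x x≤n))

  take-insertAt : ∀ p k m σ → p ≤ k → take (suc k) (insertAt p m σ) ≡ insertAt p m (take k σ)
  take-insertAt zero    k       m σ       _        = refl
  take-insertAt (suc p) (suc k) m []      _        = refl
  take-insertAt (suc p) (suc k) m (x ∷ σ) (s≤s p≤k) = cong (x ∷_) (take-insertAt p k m σ p≤k)

  drop-insertAt : ∀ p k m σ → p ≤ k → drop (suc k) (insertAt p m σ) ≡ drop k σ
  drop-insertAt zero    k       m σ       _         = refl
  drop-insertAt (suc p) zero    m []      _         = refl
  drop-insertAt (suc p) (suc k) m []      _         = refl
  drop-insertAt (suc p) (suc k) m (x ∷ σ) (s≤s p≤k) = drop-insertAt p k m σ p≤k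

  take-insertAt-+ : ∀ k q m σ → k ≤ length σ → take k (insertAt (k + q) m σ) ≡ take k σ
  take-insertAt-+ zero    q m σ       _         = refl
  take-insertAt-+ (suc k) q m (x ∷ σ) (s≤s k≤|σ|) = cong (x ∷_) (take-insertAt-+ k q m σ k≤|σ|)

  drop-insertAt-+ : ∀ k q m σ → k ≤ length σ → drop k (insertAt (k + q) m σ) ≡ insertAt q m (drop k σ)
  drop-insertAt-+ zero    q m σ       _         = refl
  drop-insertAt-+ (suc k) q m (x ∷ σ) (s≤s k≤|σ|) = drop-insertAt-+ k q m σ k≤|σ|

  length-filter-map : {P Q : ℕ → Set} (P? : Decidable P) (Q? : Decidable Q) (f : ℕ → ℕ) →
    (∀ y → P (f y) → Q y) → (∀ y → Q y → P (f y)) → ∀ w → length (filter P? (map f w)) ≡ length (filter Q? w)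
  length-filter-map P? Q? f P⇒Q Q⇒P []      = refl
  length-filter-map P? Q? f P⇒Q Q⇒P (y ∷ w) with Q? y
  ... | yes qy = trans (cong length (filter-accept P? (Q⇒P y qy))) (cong suc (length-filter-map P? Q? f P⇒Q Q⇒P w))
  ... | no ¬qy = trans (cong length (filter-reject P? (¬qy ∘ P⇒Q y))) (length-filter-map P? Q? f P⇒Q Q⇒P w)

  module _ (f : ℕ → ℕ) (f-mono : ∀ {a b} → a < b → f a < f b) where

    private
      f-reflects-< : ∀ {a b} → f a < f b → a < b
      f-reflects-< {a} {b} fa<fb with <-cmp a b
      ... | tri< a<b _ _ = a<b
      ... | tri≈ _ refl _ = ⊥-elim (<-irrefl refl fa<fb)
      ... | tri> _ _ b<a = ⊥-elim (<-asym fa<fb (f-mono b<a))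

      f-injective : ∀ {a b} → f a ≡ f b → a ≡ b
      f-injective {a} {b} fa≡fb with <-cmp a b
      ... | tri< a<b _ _ = ⊥-elim (<-irrefl fa≡fb (f-mono a<b))
      ... | tri≈ _ a≡b _ = a≡b
      ... | tri> _ _ b<a = ⊥-elim (<-irrefl (sym fa≡fb) (f-mono b<a))

      countLt-map : ∀ x w → countLt (f x) (map f w) ≡ countLt x w
      countLt-map x = length-filter-map (ℕ._<? f x) (ℕ._<? x) f (λ _ → f-reflects-<) (λ _ → f-mono)

      countEq-map : ∀ x w → countEq (f x) (map f w) ≡ countEq x w
      countEq-map x = length-filter-map (ℕ._≟ f x) (ℕ._≟ x) f (λ _ → f-injective) (λ _ → cong f)

      stdAux-map : ∀ w pre xs → stdAux (map f w) (map f pre) (map f xs) ≡ stdAux w pre xs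
      stdAux-map w pre []       = refl
      stdAux-map w pre (x ∷ xs) =
        cong₂ _∷_ (cong suc (cong₂ _+_ (countLt-map x w) (countEq-map x pre)))
          (trans (cong (λ pre′ → stdAux (map f w) pre′ (map f xs)) (sym (map-++ f pre [ x ]))) (stdAux-map w (pre ++ [ x ]) xs))

    Std-map : ∀ w → Std (map f w) ≡ Std w
    Std-map w = stdAux-map w [] w

  -- shift p fixes 1, …, p and increments every larger letter.
  shift : ℕ → ℕ → ℕ
  shift p       zero    = zero
  shift zero    (suc j) = suc (suc j)
  shift (suc p) (suc j) = suc (shift p j)

  shift-< : ∀ p {a b} → a < b → shift p a < shift p b
  shift-< zero    {zero}  {suc b} _         = s≤s z≤n
  shift-< (suc p) {zero}  {suc b} _         = s≤s z≤n
  shift-< zero    {suc a} {suc b} (s≤s a<b) = s≤s (s≤s a<b)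
  shift-< (suc p) {suc a} {suc b} (s≤s a<b) = s≤s (shift-< p a<b)

  indexOf-insertAt-≢ : ∀ i p m u → i ≢ m → p ≤ length u →
    suc (indexOf i (insertAt p m u)) ≡ shift p (suc (indexOf i u))
  indexOf-insertAt-≢ i zero    m u       i≢m _ rewrite ⌊≟⌋-≢ (i≢m ∘ sym) = refl
  indexOf-insertAt-≢ i (suc p) m (y ∷ u) i≢m (s≤s p≤|u|) with y ℕ.≟ i
  ... | yes _ = refl
  ... | no _  = cong suc (indexOf-insertAt-≢ i p m u i≢m p≤|u|)

  length-inv : ∀ w → length (inv w) ≡ length w
  length-inv w = trans (length-map _ (range (length w))) (length-range (length w))

  inv-insertAt : ∀ n p u → length u ≡ n → suc n ∉ u → p ≤ n →
    inv (insertAt p (suc n) u) ≡ map (shift p) (inv u) ++ [ suc p ]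
  inv-insertAt n p u |u|≡n m∉u p≤n = begin
      map position (range (length (insertAt p (suc n) u)))
    ≡⟨ cong (map position ∘ range) (trans (length-insertAt p (suc n) u) (cong suc |u|≡n)) ⟩
      map position (range (suc n))
    ≡⟨ cong (map position) (range-suc n) ⟩
      map position (range n ++ [ suc n ])
    ≡⟨ map-++ position (range n) [ suc n ] ⟩
      map position (range n) ++ [ suc (indexOf (suc n) (insertAt p (suc n) u)) ]
    ≡⟨ cong₂ (λ ws i → ws ++ [ suc i ]) shifted (indexOf-insertAt p (suc n) u m∉u p≤|u|) ⟩
      map (shift p) (inv u) ++ [ suc p ]
    ∎
    where
    open ≡-Reasoning
    p≤|u| = subst (p ≤_) (sym |u|≡n) p≤n
    position : ℕ → ℕ
    position i = suc (indexOf i (insertAt p (suc n) u))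
    shifted : map position (range n) ≡ map (shift p) (inv u)
    shifted = begin
        map position (range n)
      ≡⟨ map-cong-local (All.tabulate (λ i∈ → indexOf-insertAt-≢ _ p (suc n) u (λ i≡m → <-irrefl i≡m (s≤s (proj₂ (∈-range⁻ i∈))))
                                                                  p≤|u|)) ⟩
        map (shift p ∘ λ i → suc (indexOf i u)) (range n)
      ≡⟨ map-∘ (range n) ⟩
        map (shift p) (map (λ i → suc (indexOf i u)) (range n))
      ≡⟨ cong (λ k → map (shift p) (map (λ i → suc (indexOf i u)) (range k))) (sym |u|≡n) ⟩
        map (shift p) (inv u)
      ∎

  indexOf-injective : ∀ {i j} w → i ∈ w → j ∈ w → indexOf i w ≡ indexOf j w → i ≡ j
  indexOf-injective {i} {j} (y ∷ w) i∈ j∈ i≡j with y ℕ.≟ i | y ℕ.≟ j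
  ... | yes y≡i | yes y≡j = trans (sym y≡i) y≡j
  ... | yes _   | no _    = ⊥-elim (0≢1+n i≡j)
  ... | no _    | yes _   = ⊥-elim (0≢1+n (sym i≡j))
  indexOf-injective (y ∷ w) (here refl) _           _   | no y≢i | no _   = ⊥-elim (y≢i refl)
  indexOf-injective (y ∷ w) (there _)   (here refl) _   | no _   | no y≢j = ⊥-elim (y≢j refl)
  indexOf-injective (y ∷ w) (there i∈)  (there j∈)  i≡j | no _   | no _   = indexOf-injective w i∈ j∈ (suc-injective i≡j)

  Unique-map-local : ∀ (f : ℕ → ℕ) xs → (∀ {x y} → x ∈ xs → y ∈ xs → f x ≡ f y → x ≡ y) →
    Unique xs → Unique (map f xs)
  Unique-map-local f []       _     _                   = []
  Unique-map-local f (x ∷ xs) f-inj (x∉xs ∷ xs-unique) =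
    All.tabulate fx∉ ∷ Unique-map-local f xs (λ x∈ y∈ → f-inj (there x∈) (there y∈)) xs-unique
    where
    fx∉ : ∀ {z} → z ∈ map f xs → f x ≢ z
    fx∉ z∈ fx≡z with ∈-map⁻ f z∈
    ... | y , y∈ , refl = All.lookup x∉xs y∈ (f-inj (here refl) (there y∈) fx≡z)

  inv-Perm : ∀ {n α} → Perm n α → Perm n (inv α)
  inv-Perm {n} {α} α↭ = unique-bounded⇒Perm n (inv α) inv-unique inv-bounded (trans (length-inv α) (Perm-length α↭))
    where
    ∈α : ∀ {i} → i ∈ range (length α) → i ∈ α
    ∈α i∈ = let 1≤i , i≤|α| = ∈-range⁻ i∈ in Perm-∋ α↭ 1≤i (subst (_ ≤_) (Perm-length α↭) i≤|α|)
    inv-unique : Unique (inv α)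
    inv-unique = Unique-map-local _ (range (length α))
      (λ i∈ j∈ i≡j → indexOf-injective α (∈α i∈) (∈α j∈) (suc-injective i≡j)) (range-unique (length α))
    inv-bounded : Bounded n (inv α)
    inv-bounded x∈ with ∈-map⁻ _ x∈
    ... | i , i∈ , refl = s≤s z≤n , subst (suc (indexOf i α) ≤_) (Perm-length α↭) (indexOf< i α (∈α i∈))

  take-++-length : ∀ (xs ys : List ℕ) → take (length xs) (xs ++ ys) ≡ xs
  take-++-length []       ys = refl
  take-++-length (x ∷ xs) ys = cong (x ∷_) (take-++-length xs ys)

  -- The first n positions of α⁻¹ list where 1, …, n occur in α; erasing n+1 only shifts them.
  Std-take-inv : ∀ {n α} → Perm (suc n) α → Std (take n (inv α)) ≡ inv (eraseMax α)
  Std-take-inv {n} {α} α↭ = begin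
      Std (take n (inv α))
    ≡⟨ cong (Std ∘ take n ∘ inv) (sym (insertAt-eraseMax α↭)) ⟩
      Std (take n (inv (insertAt p (suc n) α′)))
    ≡⟨ cong (Std ∘ take n) (inv-insertAt n p α′ (Perm-length α′↭) (max∉eraseMax α↭) (indexOf-max≤ α↭)) ⟩
      Std (take n (map (shift p) (inv α′) ++ [ suc p ]))
    ≡⟨ cong Std (subst (λ k → take k (map (shift p) (inv α′) ++ [ suc p ]) ≡ map (shift p) (inv α′))
                       |shifted| (take-++-length _ _)) ⟩
      Std (map (shift p) (inv α′))
    ≡⟨ Std-map (shift p) (shift-< p) (inv α′) ⟩
      Std (inv α′)
    ≡⟨ Std-Perm (inv-Perm α′↭) ⟩
      inv α′
    ∎
    where
    open ≡-Reasoning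
    α′ = eraseMax α
    p = indexOf (suc n) α
    α′↭ = eraseMax-Perm α↭
    |shifted| : length (map (shift p) (inv α′)) ≡ n
    |shifted| = trans (length-map (shift p) (inv α′)) (trans (length-inv α′) (Perm-length α′↭))

  drop-last : ∀ n (w : List ℕ) → length w ≡ suc n → Σ ℕ (λ x → drop n w ≡ [ x ])
  drop-last zero    (x ∷ []) _       = x , refl
  drop-last (suc n) (x ∷ w)  |w|≡2+n = drop-last n w (suc-injective |w|≡2+n)

  -- Counting the words of ∂(G_α G_β) and of G_τ F_1

  inShuffle : List ℕ → List ℕ → List ℕ → ℕ
  inShuffle α β γ = δ (Std (take (length α) γ)) α * δ (Std (drop (length α) γ)) β

  ∑-shuffleSet : ∀ α β (f : List ℕ → ℕ) →
    ∑ (shuffleSet α β) f ≡ ∑[ γ ∈ allPerms (length α + length β) ] inShuffle α β γ * f γ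
  ∑-shuffleSet α β f = trans (∑-filter _ (allPerms (length α + length β)) f) (∑-cong (allPerms (length α + length β)) indicator)
    where
    indicator : ∀ γ →
      𝟙 (does (≡-dec ℕ._≟_ (Std (take (length α) γ)) α ×-dec ≡-dec ℕ._≟_ (Std (drop (length α) γ)) β)) * f γ
        ≡ inShuffle α β γ * f γ
    indicator γ = cong (_* f γ) (trans (𝟙-∧ (does left?) (does right?))
                                       (sym (cong₂ (λ a b → 𝟙 a * 𝟙 b) (isYes≗does left?) (isYes≗does right?))))
      where
      left?  = ≡-dec ℕ._≟_ (Std (take (length α) γ)) α
      right? = ≡-dec ℕ._≟_ (Std (drop (length α) γ)) β

  ∑-pick : ∀ L σ (g : List ℕ → ℕ) → ∑[ γ ∈ L ] g γ * δ γ σ ≡ g σ * mult L σ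
  ∑-pick L σ g = trans (∑-cong L pick) (∑-*ˡ L (g σ) _)
    where
    pick : ∀ γ → g γ * δ γ σ ≡ g σ * δ γ σ
    pick γ with ≡-dec ℕ._≟_ γ σ
    ... | yes refl = refl
    ... | no _     = trans (*-zeroʳ (g γ)) (sym (*-zeroʳ (g σ)))

  mult-shuffleSet : ∀ α β σ → mult (shuffleSet α β) σ ≡ inShuffle α β σ * 𝟙 (isPermOf (range (length α + length β)) σ)
  mult-shuffleSet α β σ = begin
      mult (shuffleSet α β) σ
    ≡⟨ ∑-shuffleSet α β _ ⟩
      ∑[ γ ∈ allPerms N ] inShuffle α β γ * δ γ σ
    ≡⟨ ∑-pick (allPerms N) σ (inShuffle α β) ⟩
      inShuffle α β σ * mult (allPerms N) σ
    ≡⟨ cong (inShuffle α β σ *_) (mult-allPerms N σ) ⟩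
      inShuffle α β σ * 𝟙 (isPermOf (range N) σ)
    ∎
    where
    open ≡-Reasoning
    N = length α + length β

  -- (f ∘∂) w is the value of f on ∂ G_w, where ∂ G_[] = 0.
  _∘∂ : (List ℕ → ℕ) → List ℕ → ℕ
  (f ∘∂) []          = 0
  (f ∘∂) w@(_ ∷ _)   = f (eraseMax w)

  ∘∂-Perm : ∀ {n w} (f : List ℕ → ℕ) → Perm (suc n) w → (f ∘∂) w ≡ f (eraseMax w)
  ∘∂-Perm {w = []}    f w↭ with () ← Perm-length w↭
  ∘∂-Perm {w = _ ∷ _} f w↭ = refl

  δ-eraseMax : ∀ {n γ} σ → Perm (suc n) γ → δ (eraseMax γ) σ ≡ ∑[ p < suc n ] δ (insertAt p (suc n) σ) γ
  δ-eraseMax {n} {γ} σ γ↭ with suc n ∈? σ | length σ ℕ.≟ n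
  ... | yes m∈σ | _ = trans (δ-≢ (λ γ′≡σ → max∉eraseMax γ↭ (subst (suc n ∈_) (sym γ′≡σ) m∈σ)))
                            (sym (∑<-zero (suc n) (λ p → δ (insertAt p (suc n) σ) γ) (λ p _ → δ-≢ (λ σ⁺≡γ →
                              max-twice p (subst Unique (sym σ⁺≡γ) (Perm-unique γ↭))))))
    where
    max-twice : ∀ p → ¬ Unique (insertAt p (suc n) σ)
    max-twice p σ⁺-unique = Unique[x∷xs]⇒x∉xs (Unique-resp-↭ (insertAt-↭ p (suc n) σ) σ⁺-unique) m∈σ
  ... | no _ | no |σ|≢n = trans (δ-≢ (λ γ′≡σ → |σ|≢n (trans (cong length (sym γ′≡σ)) (Perm-length (eraseMax-Perm γ↭)))))
                            (sym (∑<-zero (suc n) (λ p → δ (insertAt p (suc n) σ) γ) (λ p _ → δ-≢ (λ σ⁺≡γ → |σ|≢n (suc-injective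
                              (trans (sym (length-insertAt p (suc n) σ)) (trans (cong length σ⁺≡γ) (Perm-length γ↭))))))))
  ... | no m∉σ | yes refl = sym (begin
      ∑[ p < suc (length σ) ] δ (insertAt p (suc (length σ)) σ) γ
    ≡⟨ ∑<-δ-insertAt (suc (length σ)) σ γ m∉σ ⟩
      𝟙 (⌊ suc (length σ) ∈? γ ⌋ ∧ (removeFirst (suc (length σ)) γ ≟L σ))
    ≡⟨ cong (λ b → 𝟙 (b ∧ (removeFirst (suc (length σ)) γ ≟L σ)))
            (trans (isYes≗does (_ ∈? γ)) (dec-true (_ ∈? γ) (Perm-max∈ γ↭))) ⟩
      δ (removeFirst (suc (length σ)) γ) σ
    ≡⟨ cong (λ γ′ → δ γ′ σ) (eraseMax≡removeFirst γ↭) ⟨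
      δ (eraseMax γ) σ
    ∎)
    where open ≡-Reasoning

  -- Summing over the γ with γ′ = σ is summing over the positions of n+1 in γ.
  ∑-fibre-∂ : ∀ n σ (f : List ℕ → ℕ) →
    ∑[ γ ∈ allPerms (suc n) ] f γ * ((λ γ′ → δ γ′ σ) ∘∂) γ
      ≡ 𝟙 (isPermOf (range n) σ) * (∑[ p < suc n ] f (insertAt p (suc n) σ))
  ∑-fibre-∂ n σ f with isPermOf (range n) σ in σ?
  ... | false = ∑-zero (allPerms (suc n)) _ (λ γ γ∈ → let γ↭ = ∈-allPerms⇒Perm γ∈ in
        trans (cong (f γ *_) (trans (∘∂-Perm _ γ↭) (δ-≢ (λ γ′≡σ → true≢false
          (trans (sym (isPermOf-complete (range n) σ (subst (Perm n) γ′≡σ (eraseMax-Perm γ↭)))) σ?)))))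
        (*-zeroʳ (f γ)))
    where
    true≢false : true ≢ false
    true≢false ()
  ... | true = begin
      ∑[ γ ∈ allPerms (suc n) ] f γ * ((λ γ′ → δ γ′ σ) ∘∂) γ
    ≡⟨ ∑-cong-∈ (allPerms (suc n)) (λ γ γ∈ → let γ↭ = ∈-allPerms⇒Perm γ∈ in
         trans (cong (f γ *_) (trans (∘∂-Perm _ γ↭) (δ-eraseMax σ γ↭)))
               (sym (∑<-*ˡ (suc n) (λ p → δ (insertAt p (suc n) σ) γ) (f γ)))) ⟩
      ∑[ γ ∈ allPerms (suc n) ] ∑[ p < suc n ] f γ * δ (insertAt p (suc n) σ) γ
    ≡⟨ ∑-∑<-comm (allPerms (suc n)) (suc n) (λ γ p → f γ * δ (insertAt p (suc n) σ) γ) ⟩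
      ∑[ p < suc n ] ∑[ γ ∈ allPerms (suc n) ] f γ * δ (insertAt p (suc n) σ) γ
    ≡⟨ ∑<-cong (suc n) (λ p _ → begin
         ∑[ γ ∈ allPerms (suc n) ] f γ * δ (insertAt p (suc n) σ) γ
       ≡⟨ ∑-cong (allPerms (suc n)) (λ γ → cong (f γ *_) (δ-sym _ γ)) ⟩
         ∑[ γ ∈ allPerms (suc n) ] f γ * δ γ (insertAt p (suc n) σ)
       ≡⟨ ∑-pick (allPerms (suc n)) _ f ⟩
         f (insertAt p (suc n) σ) * mult (allPerms (suc n)) (insertAt p (suc n) σ)
       ≡⟨ cong (f (insertAt p (suc n) σ) *_) (mult-allPerms-Perm (Perm-insertAt p σ↭)) ⟩
         f (insertAt p (suc n) σ) * 1
       ≡⟨ *-identityʳ _ ⟩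
         f (insertAt p (suc n) σ)
       ∎) ⟩
      ∑[ p < suc n ] f (insertAt p (suc n) σ)
    ≡⟨ +-identityʳ _ ⟨
      1 * (∑[ p < suc n ] f (insertAt p (suc n) σ))
    ∎
    where
    open ≡-Reasoning
    σ↭ : Perm n σ
    σ↭ = isPermOf-sound (range n) σ σ?

  ∑<-inShuffle-left : ∀ α β n σ → IsPerm α → Perm n σ → length α + length β ≡ suc n →
    ∑[ p < length α ] inShuffle α β (insertAt p (suc n) σ) ≡ ((λ α′ → inShuffle α′ β σ) ∘∂) α
  ∑<-inShuffle-left []           β n σ _  _  _         = refl
  ∑<-inShuffle-left α@(_ ∷ as) β n σ α↭ σ↭ |α|+|β|≡1+n = begin
      ∑[ p < suc k ] inShuffle α β (insertAt p (suc n) σ)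
    ≡⟨ ∑<-cong (suc k) (λ p p<1+k → inserted p (≤-pred p<1+k)) ⟩
      ∑[ p < suc k ] δ (insertAt p (suc k) τ) α * rest
    ≡⟨ ∑<-*ʳ (suc k) (λ p → δ (insertAt p (suc k) τ) α) rest ⟩
      (∑[ p < suc k ] δ (insertAt p (suc k) τ) α) * rest
    ≡⟨ cong (_* rest) (trans (δ-sym τ (eraseMax α)) (δ-eraseMax τ α↭)) ⟨
      δ τ (eraseMax α) * rest
    ≡⟨ cong (λ j → δ (Std (take j σ)) (eraseMax α) * δ (Std (drop j σ)) β) (Perm-length (eraseMax-Perm α↭)) ⟨
      inShuffle (eraseMax α) β σ
    ∎
    where
    open ≡-Reasoning
    k = length as
    τ = Std (take k σ)
    rest = δ (Std (drop k σ)) β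
    |take-k| : length (take k σ) ≡ k
    |take-k| = trans (length-take k σ) (m≤n⇒m⊓n≡m (subst (k ≤_) (sym (Perm-length σ↭))
                 (subst (k ≤_) (suc-injective |α|+|β|≡1+n) (m≤m+n k (length β)))))
    inserted : ∀ p → p ≤ k → inShuffle α β (insertAt p (suc n) σ) ≡ δ (insertAt p (suc k) τ) α * rest
    inserted p p≤k = begin
        δ (Std (take (suc k) (insertAt p (suc n) σ))) α * δ (Std (drop (suc k) (insertAt p (suc n) σ))) β
      ≡⟨ cong₂ (λ u v → δ (Std u) α * δ (Std v) β) (take-insertAt p k (suc n) σ p≤k) (drop-insertAt p k (suc n) σ p≤k) ⟩
        δ (Std (insertAt p (suc n) (take k σ))) α * rest
      ≡⟨ cong (λ u → δ u α * rest) (Std-insertAt p (suc n) (take k σ) (AllP.take⁺ k (Perm-< σ↭))) ⟩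
        δ (insertAt p (suc (length (take k σ))) τ) α * rest
      ≡⟨ cong (λ j → δ (insertAt p (suc j) τ) α * rest) |take-k| ⟩
        δ (insertAt p (suc k) τ) α * rest
      ∎

  ∑<-inShuffle-right : ∀ α β n σ → IsPerm β → Perm n σ → length α + length β ≡ suc n →
    ∑[ q < length β ] inShuffle α β (insertAt (length α + q) (suc n) σ) ≡ ((λ β′ → inShuffle α β′ σ) ∘∂) β
  ∑<-inShuffle-right α []           n σ _  _  _         = refl
  ∑<-inShuffle-right α β@(_ ∷ bs) n σ β↭ σ↭ |α|+|β|≡1+n = begin
      ∑[ q < suc l ] inShuffle α β (insertAt (k + q) (suc n) σ)
    ≡⟨ ∑<-cong (suc l) (λ q _ → inserted q) ⟩
      ∑[ q < suc l ] rest * δ (insertAt q (suc l) τ) β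
    ≡⟨ ∑<-*ˡ (suc l) (λ q → δ (insertAt q (suc l) τ) β) rest ⟩
      rest * (∑[ q < suc l ] δ (insertAt q (suc l) τ) β)
    ≡⟨ cong (rest *_) (trans (δ-sym τ (eraseMax β)) (δ-eraseMax τ β↭)) ⟨
      inShuffle α (eraseMax β) σ
    ∎
    where
    open ≡-Reasoning
    k = length α
    l = length bs
    τ = Std (drop k σ)
    rest = δ (Std (take k σ)) α
    k+l≡n : k + l ≡ n
    k+l≡n = suc-injective (trans (sym (+-suc k l)) |α|+|β|≡1+n)
    k≤|σ| : k ≤ length σ
    k≤|σ| = subst (k ≤_) (trans k+l≡n (sym (Perm-length σ↭))) (m≤m+n k l)
    |drop-k| : length (drop k σ) ≡ l
    |drop-k| = trans (length-drop k σ) (trans (cong (_∸ k) (trans (Perm-length σ↭) (sym k+l≡n))) (m+n∸m≡n k l))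
    inserted : ∀ q → inShuffle α β (insertAt (k + q) (suc n) σ) ≡ rest * δ (insertAt q (suc l) τ) β
    inserted q = begin
        δ (Std (take k (insertAt (k + q) (suc n) σ))) α * δ (Std (drop k (insertAt (k + q) (suc n) σ))) β
      ≡⟨ cong₂ (λ u v → δ (Std u) α * δ (Std v) β) (take-insertAt-+ k q (suc n) σ k≤|σ|) (drop-insertAt-+ k q (suc n) σ k≤|σ|) ⟩
        rest * δ (Std (insertAt q (suc n) (drop k σ))) β
      ≡⟨ cong (λ v → rest * δ v β) (Std-insertAt q (suc n) (drop k σ) (AllP.drop⁺ k (Perm-< σ↭))) ⟩
        rest * δ (insertAt q (suc (length (drop k σ))) τ) β
      ≡⟨ cong (λ j → rest * δ (insertAt q (suc j) τ) β) |drop-k| ⟩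
        rest * δ (insertAt q (suc l) τ) β
      ∎

  ∑<-inShuffle-insertAt : ∀ α β n σ → IsPerm α → IsPerm β → Perm n σ → length α + length β ≡ suc n →
    ∑[ p < suc n ] inShuffle α β (insertAt p (suc n) σ)
      ≡ ((λ α′ → inShuffle α′ β σ) ∘∂) α + ((λ β′ → inShuffle α β′ σ) ∘∂) β
  ∑<-inShuffle-insertAt α β n σ α↭ β↭ σ↭ |α|+|β|≡1+n = begin
      ∑[ p < suc n ] inShuffle α β (insertAt p (suc n) σ)
    ≡⟨ cong (λ N → ∑[ p < N ] inShuffle α β (insertAt p (suc n) σ)) |α|+|β|≡1+n ⟨
      ∑[ p < length α + length β ] inShuffle α β (insertAt p (suc n) σ)
    ≡⟨ ∑<-+ (length α) (length β) _ ⟩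
      (∑[ p < length α ] inShuffle α β (insertAt p (suc n) σ)) + (∑[ q < length β ] inShuffle α β (insertAt (length α + q) (suc n) σ))
    ≡⟨ cong₂ _+_ (∑<-inShuffle-left α β n σ α↭ σ↭ |α|+|β|≡1+n) (∑<-inShuffle-right α β n σ β↭ σ↭ |α|+|β|≡1+n) ⟩
      ((λ α′ → inShuffle α′ β σ) ∘∂) α + ((λ β′ → inShuffle α β′ σ) ∘∂) β
    ∎
    where open ≡-Reasoning

  𝟙-guard : ∀ b {x y} → (b ≡ true → x ≡ y) → 𝟙 b * x ≡ 𝟙 b * y
  𝟙-guard true  x≡y = cong (_+ 0) (x≡y refl)
  𝟙-guard false _   = refl

  mult-shuffleSet-∂ˡ : ∀ α β n σ → IsPerm α → length α + length β ≡ suc n →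
    ((λ α′ → mult (shuffleSet α′ β) σ) ∘∂) α ≡ ((λ α′ → inShuffle α′ β σ) ∘∂) α * 𝟙 (isPermOf (range n) σ)
  mult-shuffleSet-∂ˡ []           β n σ _  _         = refl
  mult-shuffleSet-∂ˡ α@(_ ∷ as) β n σ α↭ |α|+|β|≡1+n =
    trans (mult-shuffleSet (eraseMax α) β σ)
          (cong (λ N → inShuffle (eraseMax α) β σ * 𝟙 (isPermOf (range N) σ))
                (trans (cong (_+ length β) (Perm-length (eraseMax-Perm α↭))) (suc-injective |α|+|β|≡1+n)))

  mult-shuffleSet-∂ʳ : ∀ α β n σ → IsPerm β → length α + length β ≡ suc n →
    ((λ β′ → mult (shuffleSet α β′) σ) ∘∂) β ≡ ((λ β′ → inShuffle α β′ σ) ∘∂) β * 𝟙 (isPermOf (range n) σ)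
  mult-shuffleSet-∂ʳ α []           n σ _  _         = refl
  mult-shuffleSet-∂ʳ α β@(_ ∷ bs) n σ β↭ |α|+|β|≡1+n =
    trans (mult-shuffleSet α (eraseMax β) σ)
          (cong (λ N → inShuffle α (eraseMax β) σ * 𝟙 (isPermOf (range N) σ))
                (trans (cong (length α +_) (Perm-length (eraseMax-Perm β↭)))
                       (suc-injective (trans (sym (+-suc (length α) (length bs))) |α|+|β|≡1+n))))

  leibniz-count-suc : ∀ α β n σ → IsPerm α → IsPerm β → length α + length β ≡ suc n →
    ∑[ γ ∈ allPerms (suc n) ] inShuffle α β γ * ((λ γ′ → δ γ′ σ) ∘∂) γ
      ≡ ((λ α′ → mult (shuffleSet α′ β) σ) ∘∂) α + ((λ β′ → mult (shuffleSet α β′) σ) ∘∂) β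
  leibniz-count-suc α β n σ α↭ β↭ |α|+|β|≡1+n = begin
      ∑[ γ ∈ allPerms (suc n) ] inShuffle α β γ * ((λ γ′ → δ γ′ σ) ∘∂) γ
    ≡⟨ ∑-fibre-∂ n σ (inShuffle α β) ⟩
      𝟙 σ? * (∑[ p < suc n ] inShuffle α β (insertAt p (suc n) σ))
    ≡⟨ 𝟙-guard σ? (λ σ?≡true →
         ∑<-inShuffle-insertAt α β n σ α↭ β↭ (isPermOf-sound (range n) σ σ?≡true) |α|+|β|≡1+n) ⟩
      𝟙 σ? * (A + B)
    ≡⟨ *-comm (𝟙 σ?) (A + B) ⟩
      (A + B) * 𝟙 σ?
    ≡⟨ *-distribʳ-+ (𝟙 σ?) A B ⟩
      A * 𝟙 σ? + B * 𝟙 σ?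
    ≡⟨ cong₂ _+_ (mult-shuffleSet-∂ˡ α β n σ α↭ |α|+|β|≡1+n) (mult-shuffleSet-∂ʳ α β n σ β↭ |α|+|β|≡1+n) ⟨
      ((λ α′ → mult (shuffleSet α′ β) σ) ∘∂) α + ((λ β′ → mult (shuffleSet α β′) σ) ∘∂) β
    ∎
    where
    open ≡-Reasoning
    σ? = isPermOf (range n) σ
    A = ((λ α′ → inShuffle α′ β σ) ∘∂) α
    B = ((λ β′ → inShuffle α β′ σ) ∘∂) β

  leibniz-count : ∀ α β σ → IsPerm α → IsPerm β →
    ∑[ γ ∈ shuffleSet α β ] ((λ γ′ → δ γ′ σ) ∘∂) γ
      ≡ ((λ α′ → mult (shuffleSet α′ β) σ) ∘∂) α + ((λ β′ → mult (shuffleSet α β′) σ) ∘∂) β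
  leibniz-count α β σ α↭ β↭ = trans (∑-shuffleSet α β _) (by-length α β α↭ β↭)
    where
    by-length : ∀ α β → IsPerm α → IsPerm β →
      ∑[ γ ∈ allPerms (length α + length β) ] inShuffle α β γ * ((λ γ′ → δ γ′ σ) ∘∂) γ
        ≡ ((λ α′ → mult (shuffleSet α′ β) σ) ∘∂) α + ((λ β′ → mult (shuffleSet α β′) σ) ∘∂) β
    by-length []          []          _  _  = *-zeroʳ (inShuffle [] [] [])
    by-length α@(_ ∷ _)  β           α↭ β↭ = leibniz-count-suc α β _ σ α↭ β↭ refl
    by-length []          β@(_ ∷ _)  α↭ β↭ = leibniz-count-suc [] β _ σ α↭ β↭ refl

  Std-singleton : ∀ x → Std [ x ] ≡ [ 1 ]
  Std-singleton x = cong (λ c → suc (c + 0) ∷ []) (countLt-≮ {x} (<-irrefl refl))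

  𝟙-≢true : ∀ {b} → b ≢ true → 𝟙 b ≡ 0
  𝟙-≢true {true}  b≢true = ⊥-elim (b≢true refl)
  𝟙-≢true {false} _      = refl

  adjoint-count : ∀ α τ → IsPerm α → ∑[ γ ∈ shuffleSet τ [ 1 ] ] δ (inv α) γ ≡ ((λ α′ → δ (inv α′) τ) ∘∂) α
  adjoint-count α τ α↭ = begin
      ∑[ γ ∈ shuffleSet τ [ 1 ] ] δ (inv α) γ
    ≡⟨ ∑-cong (shuffleSet τ [ 1 ]) (δ-sym (inv α)) ⟩
      mult (shuffleSet τ [ 1 ]) (inv α)
    ≡⟨ mult-shuffleSet τ [ 1 ] (inv α) ⟩
      inShuffle τ [ 1 ] (inv α) * 𝟙 (isPermOf (range (length τ + 1)) (inv α))
    ≡⟨ cong (λ N → inShuffle τ [ 1 ] (inv α) * 𝟙 (isPermOf (range N) (inv α))) (+-comm (length τ) 1) ⟩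
      inShuffle τ [ 1 ] (inv α) * 𝟙 (isPermOf (range (suc m)) (inv α))
    ≡⟨ by-length α α↭ ⟩
      ((λ α′ → δ (inv α′) τ) ∘∂) α
    ∎
    where
    open ≡-Reasoning
    m = length τ
    by-length : ∀ α → IsPerm α →
      inShuffle τ [ 1 ] (inv α) * 𝟙 (isPermOf (range (suc m)) (inv α)) ≡ ((λ α′ → δ (inv α′) τ) ∘∂) α
    by-length []           _  = *-zeroʳ (inShuffle τ [ 1 ] [])
    by-length α@(_ ∷ as) α↭ with length as ℕ.≟ m
    ... | yes |as|≡m = begin
        δ (Std (take m (inv α))) τ * δ (Std (drop m (inv α))) [ 1 ] * 𝟙 (isPermOf (range (suc m)) (inv α))
      ≡⟨ cong₂ (λ u v → δ u τ * δ v [ 1 ] * 𝟙 (isPermOf (range (suc m)) (inv α)))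
               (Std-take-inv α↭′) (trans (cong Std (proj₂ last)) (Std-singleton (proj₁ last))) ⟩
        δ (inv (eraseMax α)) τ * δ [ 1 ] [ 1 ] * 𝟙 (isPermOf (range (suc m)) (inv α))
      ≡⟨ cong₂ (λ a b → δ (inv (eraseMax α)) τ * a * 𝟙 b)
               (δ-refl [ 1 ]) (isPermOf-complete (range (suc m)) (inv α) (inv-Perm α↭′)) ⟩
        δ (inv (eraseMax α)) τ * 1 * 1
      ≡⟨ trans (*-identityʳ _) (*-identityʳ _) ⟩
        δ (inv (eraseMax α)) τ
      ∎
      where
      α↭′ : Perm (suc m) α
      α↭′ = subst (λ k → Perm (suc k) α) |as|≡m α↭
      last = drop-last m (inv α) (Perm-length (inv-Perm α↭′))
    ... | no |as|≢m = trans (cong (inShuffle τ [ 1 ] (inv α) *_) (𝟙-≢true (λ inv-α? → |as|≢m (suc-injective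
                              (trans (sym (length-inv α)) (Perm-length (isPermOf-sound (range (suc m)) (inv α) inv-α?)))))))
                        (trans (*-zeroʳ (inShuffle τ [ 1 ] (inv α))) (sym (δ-≢ (λ inv-α′≡τ → |as|≢m
                              (trans (sym (trans (length-inv (eraseMax α)) (Perm-length (eraseMax-Perm α↭)))) (cong length inv-α′≡τ))))))

open Counting using (𝟙; δ; ∑; mult; _∘∂; leibniz-count; adjoint-count)

module _ {c ℓ} (R : CommutativeRing c ℓ) where

  open CommutativeRing R
  open FQSym R
  open FieldDefs R using (natR)
  open import Algebra.Properties.CommutativeSemigroup +-commutativeSemigroup using (interchange)
  open import Relation.Binary.Reasoning.Setoid setoid

  ∑ᵗ : FQ → (List ℕ → Carrier → Carrier) → Carrier
  ∑ᵗ []            h = 0#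
  ∑ᵗ ((τ , r) ∷ X) h = h τ r + ∑ᵗ X h

  ∑ʷ : List (List ℕ) → (List ℕ → Carrier) → Carrier
  ∑ʷ []      g = 0#
  ∑ʷ (γ ∷ L) g = g γ + ∑ʷ L g

  ∑ᵗ-cong : ∀ X {h h′} → (∀ τ r → h τ r ≈ h′ τ r) → ∑ᵗ X h ≈ ∑ᵗ X h′
  ∑ᵗ-cong []            h≈h′ = refl
  ∑ᵗ-cong ((τ , r) ∷ X) h≈h′ = +-cong (h≈h′ τ r) (∑ᵗ-cong X h≈h′)

  ∑ᵗ-++ : ∀ X Y h → ∑ᵗ (X ++ Y) h ≈ ∑ᵗ X h + ∑ᵗ Y h
  ∑ᵗ-++ []            Y h = sym (+-identityˡ _)
  ∑ᵗ-++ ((τ , r) ∷ X) Y h = trans (+-congˡ (∑ᵗ-++ X Y h)) (sym (+-assoc _ _ _))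

  ∑ᵗ-concatMap : ∀ (f : List ℕ × Carrier → FQ) X h → ∑ᵗ (concatMap f X) h ≈ ∑ᵗ X (λ τ r → ∑ᵗ (f (τ , r)) h)
  ∑ᵗ-concatMap f []            h = refl
  ∑ᵗ-concatMap f ((τ , r) ∷ X) h = trans (∑ᵗ-++ (f (τ , r)) (concatMap f X) h) (+-congˡ (∑ᵗ-concatMap f X h))

  ∑ᵗ-map : ∀ L k h → ∑ᵗ (map (λ γ → (γ , k)) L) h ≈ ∑ʷ L (λ γ → h γ k)
  ∑ᵗ-map []      k h = refl
  ∑ᵗ-map (γ ∷ L) k h = +-congˡ (∑ᵗ-map L k h)

  ∑ᵗ-*ˡ : ∀ k X h → k * ∑ᵗ X h ≈ ∑ᵗ X (λ τ r → k * h τ r)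
  ∑ᵗ-*ˡ k []            h = zeroʳ k
  ∑ᵗ-*ˡ k ((τ , r) ∷ X) h = trans (distribˡ k _ _) (+-congˡ (∑ᵗ-*ˡ k X h))

  ∑ʷ-cong : ∀ L {g g′} → (∀ γ → g γ ≈ g′ γ) → ∑ʷ L g ≈ ∑ʷ L g′
  ∑ʷ-cong []      g≈g′ = refl
  ∑ʷ-cong (γ ∷ L) g≈g′ = +-cong (g≈g′ γ) (∑ʷ-cong L g≈g′)

  ∑ʷ-*ˡ : ∀ k L g → k * ∑ʷ L g ≈ ∑ʷ L (λ γ → k * g γ)
  ∑ʷ-*ˡ k []      g = zeroʳ k
  ∑ʷ-*ˡ k (γ ∷ L) g = trans (distribˡ k _ _) (+-congˡ (∑ʷ-*ˡ k L g))

  natR-+ : ∀ m n → natR (m ℕ.+ n) ≈ natR m + natR n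
  natR-+ ℕ.zero    n = sym (+-identityˡ _)
  natR-+ (ℕ.suc m) n = trans (+-congˡ (natR-+ m n)) (sym (+-assoc 1# _ _))

  natR-∑ : ∀ L (f : List ℕ → ℕ) → natR (∑ L f) ≈ ∑ʷ L (λ γ → natR (f γ))
  natR-∑ []      f = refl
  natR-∑ (γ ∷ L) f = trans (natR-+ (f γ) (∑ L f)) (+-congˡ (natR-∑ L f))

  lin : FQ → (List ℕ → Carrier) → Carrier
  lin X g = ∑ᵗ X (λ τ r → r * g τ)

  lin-cong : ∀ X {g g′} → (∀ τ → g τ ≈ g′ τ) → lin X g ≈ lin X g′
  lin-cong X g≈g′ = ∑ᵗ-cong X (λ τ r → *-congˡ (g≈g′ τ))

  lin-cong-IsFQ : ∀ X {g g′} → IsFQ X → (∀ τ → IsPerm τ → g τ ≈ g′ τ) → lin X g ≈ lin X g′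
  lin-cong-IsFQ []            _            g≈g′ = refl
  lin-cong-IsFQ ((τ , r) ∷ X) (τ↭ ∷ X-perm) g≈g′ = +-cong (*-congˡ (g≈g′ τ τ↭)) (lin-cong-IsFQ X X-perm g≈g′)

  lin-0 : ∀ X → lin X (λ _ → 0#) ≈ 0#
  lin-0 []            = refl
  lin-0 ((τ , r) ∷ X) = trans (+-cong (zeroʳ r) (lin-0 X)) (+-identityʳ 0#)

  lin-+ : ∀ X g g′ → lin X (λ τ → g τ + g′ τ) ≈ lin X g + lin X g′
  lin-+ []            g g′ = sym (+-identityʳ 0#)
  lin-+ ((τ , r) ∷ X) g g′ = trans (+-cong (distribˡ r (g τ) (g′ τ)) (lin-+ X g g′)) (interchange _ _ _ _)

  lin-⊕ : ∀ X Y g → lin (X ⊕ Y) g ≈ lin X g + lin Y g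
  lin-⊕ X Y g = ∑ᵗ-++ X Y _

  _∘∂ᶜ : (List ℕ → Carrier) → List ℕ → Carrier
  (g ∘∂ᶜ) []          = 0#
  (g ∘∂ᶜ) w@(_ ∷ _)   = g (eraseMax w)

  natR-∘∂ : ∀ (f : List ℕ → ℕ) w → natR ((f ∘∂) w) ≈ ((λ w′ → natR (f w′)) ∘∂ᶜ) w
  natR-∘∂ f []      = refl
  natR-∘∂ f (_ ∷ _) = refl

  lin-∂ : ∀ X g → lin (∂ X) g ≈ lin X (g ∘∂ᶜ)
  lin-∂ []                   g = refl
  lin-∂ (([] , r) ∷ X)       g = trans (lin-∂ X g) (sym (trans (+-congʳ (zeroʳ r)) (+-identityˡ _)))
  lin-∂ (((_ ∷ _) , r) ∷ X) g = +-congˡ (lin-∂ X g)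

  lin-∂-lin : ∀ Y (F : List ℕ → List ℕ → ℕ) α →
    ((λ α′ → lin Y (λ β → natR (F α′ β))) ∘∂ᶜ) α ≈ lin Y (λ β → natR (((λ α′ → F α′ β) ∘∂) α))
  lin-∂-lin Y F []      = sym (lin-0 Y)
  lin-∂-lin Y F (_ ∷ _) = refl

  lin-· : ∀ X Y g → lin (X · Y) g ≈ lin X (λ α → lin Y (λ β → ∑ʷ (shuffleSet α β) g))
  lin-· X Y g =
    trans (∑ᵗ-concatMap _ X _) (∑ᵗ-cong X (λ α r →
      trans (∑ᵗ-concatMap _ Y _)
            (trans (∑ᵗ-cong Y (λ β s → trans (∑ᵗ-map (shuffleSet α β) (r * s) _) (term α r β s))) (sym (∑ᵗ-*ˡ r Y _)))))
    where
    term : ∀ α r β s → ∑ʷ (shuffleSet α β) (λ γ → (r * s) * g γ) ≈ r * (s * ∑ʷ (shuffleSet α β) g)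
    term α r β s = sym (trans (*-congˡ (∑ʷ-*ˡ s (shuffleSet α β) g)) (trans (∑ʷ-*ˡ r (shuffleSet α β) _)
                     (∑ʷ-cong (shuffleSet α β) (λ γ → sym (*-assoc r s (g γ))))))

  if-natR : ∀ b k → (if b then k else 0#) ≈ k * natR (𝟙 b)
  if-natR true  k = sym (trans (*-congˡ (+-identityʳ 1#)) (*-identityʳ k))
  if-natR false k = sym (zeroʳ k)

  coeff-lin : ∀ X σ → coeff X σ ≈ lin X (λ τ → natR (δ τ σ))
  coeff-lin []            σ = refl
  coeff-lin ((τ , r) ∷ X) σ = +-cong (if-natR (τ ≟L σ) r) (coeff-lin X σ)

  coeff-⊕ : ∀ X Y σ → coeff (X ⊕ Y) σ ≈ coeff X σ + coeff Y σ
  coeff-⊕ X Y σ = trans (coeff-lin (X ⊕ Y) σ) (trans (lin-⊕ X Y _) (sym (+-cong (coeff-lin X σ) (coeff-lin Y σ))))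

  coeff-· : ∀ X Y σ → coeff (X · Y) σ ≈ lin X (λ α → lin Y (λ β → natR (mult (shuffleSet α β) σ)))
  coeff-· X Y σ = trans (coeff-lin (X · Y) σ) (trans (lin-· X Y _)
    (lin-cong X (λ α → lin-cong Y (λ β → sym (natR-∑ (shuffleSet α β) (λ γ → δ γ σ))))))

  coeff-∂-· : ∀ X Y σ →
    coeff (∂ (X · Y)) σ ≈ lin X (λ α → lin Y (λ β → natR (∑[ γ ∈ shuffleSet α β ] ((λ γ′ → δ γ′ σ) ∘∂) γ)))
  coeff-∂-· X Y σ = trans (coeff-lin (∂ (X · Y)) σ) (trans (lin-∂ (X · Y) _) (trans (lin-· X Y _)
    (lin-cong X (λ α → lin-cong Y (λ β → trans (∑ʷ-cong (shuffleSet α β) (λ γ → sym (natR-∘∂ (λ γ′ → δ γ′ σ) γ)))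
                                               (sym (natR-∑ (shuffleSet α β) ((λ γ′ → δ γ′ σ) ∘∂))))))))

  ⟨⟩-lin : ∀ X H → ⟨ X , H ⟩ ≈ lin X (λ α → lin H (λ τ → natR (δ (inv α) τ)))
  ⟨⟩-lin X H = trans (∑ᶜ-concatMap _ X) (∑ᵗ-cong X (λ α r →
    trans (∑ᶜ-map _ H) (trans (∑ᵗ-cong H (λ τ s → trans (if-natR (inv α ≟L τ) (r * s)) (*-assoc r s _))) (sym (∑ᵗ-*ˡ r H _)))))
    where
    ∑ᶜ : List Carrier → Carrier
    ∑ᶜ = foldr _+_ 0#
    ∑ᶜ-++ : ∀ xs ys → ∑ᶜ (xs ++ ys) ≈ ∑ᶜ xs + ∑ᶜ ys
    ∑ᶜ-++ []       ys = sym (+-identityˡ _)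
    ∑ᶜ-++ (x ∷ xs) ys = trans (+-congˡ (∑ᶜ-++ xs ys)) (sym (+-assoc _ _ _))
    ∑ᶜ-concatMap : ∀ (f : List ℕ × Carrier → List Carrier) X → ∑ᶜ (concatMap f X) ≈ ∑ᵗ X (λ τ r → ∑ᶜ (f (τ , r)))
    ∑ᶜ-concatMap f []            = refl
    ∑ᶜ-concatMap f ((τ , r) ∷ X) = trans (∑ᶜ-++ (f (τ , r)) (concatMap f X)) (+-congˡ (∑ᶜ-concatMap f X))
    ∑ᶜ-map : ∀ (f : List ℕ × Carrier → Carrier) Y → ∑ᶜ (map f Y) ≈ ∑ᵗ Y (λ τ s → f (τ , s))
    ∑ᶜ-map f []            = refl
    ∑ᶜ-map f ((τ , s) ∷ Y) = +-congˡ (∑ᶜ-map f Y)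

  lin-·F₁ : ∀ H g → lin (H · F (1 ∷ [])) g ≈ lin H (λ τ → ∑ʷ (shuffleSet τ [ 1 ]) g)
  lin-·F₁ H g = trans (lin-· H (F (1 ∷ [])) g) (lin-cong H (λ τ → trans (+-identityʳ _) (*-identityˡ _)))

  leibniz : ∀ X Y → IsFQ X → IsFQ Y → ∂ (X · Y) ≈Q ((∂ X · Y) ⊕ (X · ∂ Y))
  leibniz X Y X-perm Y-perm σ = begin
      coeff (∂ (X · Y)) σ
    ≈⟨ coeff-∂-· X Y σ ⟩
      lin X (λ α → lin Y (λ β → natR (∑[ γ ∈ shuffleSet α β ] ((λ γ′ → δ γ′ σ) ∘∂) γ)))
    ≈⟨ lin-cong-IsFQ X X-perm (λ α α↭ → lin-cong-IsFQ Y Y-perm (λ β β↭ →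
         trans (reflexive (≡.cong natR (leibniz-count α β σ α↭ β↭))) (natR-+ (A α β) (B α β)))) ⟩
      lin X (λ α → lin Y (λ β → natR (A α β) + natR (B α β)))
    ≈⟨ trans (lin-cong X (λ α → lin-+ Y _ _)) (lin-+ X _ _) ⟩
      lin X (λ α → lin Y (λ β → natR (A α β))) + lin X (λ α → lin Y (λ β → natR (B α β)))
    ≈⟨ +-cong ∂X·Y X·∂Y ⟨
      coeff (∂ X · Y) σ + coeff (X · ∂ Y) σ
    ≈⟨ coeff-⊕ (∂ X · Y) (X · ∂ Y) σ ⟨
      coeff ((∂ X · Y) ⊕ (X · ∂ Y)) σ
    ∎
    where
    A B : List ℕ → List ℕ → ℕ
    A α β = ((λ α′ → mult (shuffleSet α′ β) σ) ∘∂) α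
    B α β = ((λ β′ → mult (shuffleSet α β′) σ) ∘∂) β
    ∂X·Y : coeff (∂ X · Y) σ ≈ lin X (λ α → lin Y (λ β → natR (A α β)))
    ∂X·Y = trans (coeff-· (∂ X) Y σ) (trans (lin-∂ X _) (lin-cong X (lin-∂-lin Y (λ α β → mult (shuffleSet α β) σ))))
    X·∂Y : coeff (X · ∂ Y) σ ≈ lin X (λ α → lin Y (λ β → natR (B α β)))
    X·∂Y = trans (coeff-· X (∂ Y) σ) (lin-cong X (λ α →
             trans (lin-∂ Y _) (lin-cong Y (λ β → sym (natR-∘∂ (λ β′ → mult (shuffleSet α β′) σ) β)))))

  adjoint : ∀ X H → IsFQ X → IsFQ H → ⟨ ∂ X , H ⟩ ≈ ⟨ X , H · F (1 ∷ []) ⟩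
  adjoint X H X-perm _ = begin
      ⟨ ∂ X , H ⟩
    ≈⟨ ⟨⟩-lin (∂ X) H ⟩
      lin (∂ X) (λ α → lin H (λ τ → natR (δ (inv α) τ)))
    ≈⟨ trans (lin-∂ X _) (lin-cong X (lin-∂-lin H (λ α τ → δ (inv α) τ))) ⟩
      lin X (λ α → lin H (λ τ → natR (((λ α′ → δ (inv α′) τ) ∘∂) α)))
    ≈⟨ lin-cong-IsFQ X X-perm (λ α α↭ → lin-cong H (λ τ → reflexive (≡.cong natR (adjoint-count α τ α↭)))) ⟨
      lin X (λ α → lin H (λ τ → natR (∑[ γ ∈ shuffleSet τ [ 1 ] ] δ (inv α) γ)))
    ≈⟨ lin-cong X (λ α → trans (lin-cong H (λ τ → natR-∑ (shuffleSet τ [ 1 ]) (δ (inv α)))) (sym (lin-·F₁ H _))) ⟩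
      lin X (λ α → lin (H · F (1 ∷ [])) (λ τ → natR (δ (inv α) τ)))
    ≈⟨ ⟨⟩-lin X (H · F (1 ∷ [])) ⟨
      ⟨ X , H · F (1 ∷ []) ⟩
    ∎

proposition2p1 : ∀ {c ℓ} (R : CommutativeRing c ℓ) → FieldDefs.IsFieldChar0 R →
    let open FQSym R
        open CommutativeRing R using (_≈_)
    in (∀ X Y → IsFQ X → IsFQ Y → ∂ (X · Y) ≈Q ((∂ X · Y) ⊕ (X · ∂ Y)))
       × (∀ X H → IsFQ X → IsFQ H → ⟨ ∂ X , H ⟩ ≈ ⟨ X , H · F (1 ∷ []) ⟩)
proposition2p1 R _ = leibniz R , adjoint R
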